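{- For $0\le l\le n-2$, \[ \sum_{k=0}^{l}X_{P_k}X_{C_{n-k}}=\sum_{I\vDash n}\bigl(\sigma_I^+(l+1)-1\bigr)w_I\,e_I. \] Dually, for $2\le m\le n-1$, \[ \sum_{i=2}^{m}X_{C_i}X_{P_{n-i}}=\sum_{I\vDash n}\sigma_{\overline I}^-(m)\,w_I\,e_I. \]
   Context: $P_k$ is the path on $k$ vertices ($P_0$ the empty graph, $X_{P_0}=1$); $C_m$ the cycle on $m$ vertices ($C_2$: two vertices joined by an edge). A composition $I=i_1\cdots i_s\vDash n$ is a sequence of positive integers with sum $n$; $\overline I=i_s\cdots i_1$; $e_I=e_{i_1}\cdots e_{i_s}$ (elementary symmetric functions); $w_I=i_1\prod_{j\ge2}(i_j-1)$. For $0\le c\le n$, $\sigma_I^+(c)=\min\{i_1+\dots+i_k:0\le k\le s,\ i_1+\dots+i_k\ge c\}$ and $\sigma_I^-(c)=\max\{i_1+\dots+i_k:0\le k\le s,\ i_1+\dots+i_k\le c\}$. The chromatic symmetric function is $X_G=\sum_\kappa\prod_vx_{\kappa(v)}$ over proper colorings $\kappa$. -}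

module Defs where

open import Data.Nat as ℕ using (ℕ; zero; suc; _∸_; _⊔_; _⊓_; _≤?_)
open import Data.Integer as ℤ using (ℤ; +_; _+_; _*_)
open import Data.Fin as Fin using (Fin; toℕ)
open import Data.Bool using (Bool; true; false; _∧_; _∨_; not; if_then_else_)
open import Data.List using (List; []; _∷_; map; foldr; concatMap; allFin; upTo; filter; scanl; reverse)
open import Data.Bool.ListAction using (and)
open import Relation.Nullary.Decidable using (⌊_⌋)
import Data.Vec.Functional as VF

sumℤ : List ℤ → ℤ
sumℤ = foldr _+_ (+ 0)

prodℤ : List ℤ → ℤ
prodℤ = foldr _*_ (+ 1)

-- Σ_{i=a}^{b} f i   (empty if b < a)
sumRange : ℕ → ℕ → (ℕ → ℤ) → ℤ
sumRange a b f = sumℤ (map (λ j → f (a ℕ.+ j)) (upTo (suc b ∸ a)))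

record Graph : Set where
  field
    V   : ℕ
    adj : Fin V → Fin V → Bool
open Graph public

_==_ : ℕ → ℕ → Bool
m == n = ⌊ m ℕ.≟ n ⌋

P : ℕ → Graph
P k = record { V = k ; adj = λ i j → (suc (toℕ i) == toℕ j) ∨ (suc (toℕ j) == toℕ i) }

-- Cycle C_m on vertices 0..m-1, edges {i,i+1} and {0,m-1}
-- (for m = 2 this is a single edge; only m ≥ 2 is used).
C : ℕ → Graph
C m = record { V = m ; adj = λ i j →
        (suc (toℕ i) == toℕ j) ∨ (suc (toℕ j) == toℕ i)
        ∨ ((toℕ i == 0) ∧ (toℕ j == (m ∸ 1)) ∧ not (m == 1))
        ∨ ((toℕ j == 0) ∧ (toℕ i == (m ∸ 1)) ∧ not (m == 1)) }

allFuns : (V N : ℕ) → List (Fin V → Fin N)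
allFuns zero    N = (λ ()) ∷ []
allFuns (suc V) N = concatMap (λ c → map (λ f → c VF.∷ f) (allFuns V N)) (allFin N)

proper : (G : Graph) {N : ℕ} → (Fin (V G) → Fin N) → Bool
proper G κ = and (concatMap (λ i → map (λ j →
               not (adj G i j) ∨ not ⌊ κ i Fin.≟ κ j ⌋) (allFin (V G))) (allFin (V G)))

-- Chromatic symmetric function X_G evaluated in N variables x_0..x_{N-1}:
-- X_G(x) = Σ_{κ proper} Π_v x_{κ(v)}.
X : Graph → {N : ℕ} → (Fin N → ℤ) → ℤ
X G {N} x = sumℤ (map (λ κ → if proper G κ
                               then prodℤ (map (λ v → x (κ v)) (allFin (V G)))
                               else + 0)
                      (allFuns (V G) N))

-- Elementary symmetric polynomial e_k(x_0,…,x_{N-1})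
-- (sum over k-subsets, by the subset recursion on the first variable).
e : ℕ → {N : ℕ} → (Fin N → ℤ) → ℤ
e zero    x = + 1
e (suc k) {zero}  x = + 0
e (suc k) {suc N} x = e (suc k) (VF.tail x) + x Fin.zero * e k (VF.tail x)

-- A composition is a list of positive integers.
-- compositions n lists every composition of n exactly once:
-- a composition of n+1 arises uniquely from one of n either by
-- prepending a part 1, or by increasing its first part by 1.

incFirst : List ℕ → List (List ℕ)
incFirst []      = []
incFirst (a ∷ c) = (suc a ∷ c) ∷ []

compositions : ℕ → List (List ℕ)
compositions zero    = [] ∷ []
compositions (suc n) = concatMap (λ c → (1 ∷ c) ∷ incFirst c) (compositions n)

sumComp : ℕ → (List ℕ → ℤ) → ℤ
sumComp n f = sumℤ (map f (compositions n))

eI : List ℕ → {N : ℕ} → (Fin N → ℤ) → ℤ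
eI I x = prodℤ (map (λ i → e i x) I)

w : List ℕ → ℕ
w []      = 1
w (a ∷ I) = a ℕ.* foldr ℕ._*_ 1 (map (λ b → b ∸ 1) I)

partialSums : List ℕ → List ℕ
partialSums = scanl ℕ._+_ 0

-- σ⁺_I(c) = min { partial sums ≥ c }  (the list contains n ≥ c when c ≤ n)
σ⁺ : List ℕ → ℕ → ℕ
σ⁺ I c = foldr _⊓_ (foldr ℕ._+_ 0 I) (filter (c ≤?_) (partialSums I))

-- σ⁻_I(c) = max { partial sums ≤ c }  (the list always contains 0)
σ⁻ : List ℕ → ℕ → ℕ
σ⁻ I c = foldr _⊔_ 0 (filter (_≤? c) (partialSums I))

rev : List ℕ → List ℕ
rev = reverse

{-# OPTIONS --safe #-}
module Submission where

-- Work in ℤ[[z]] with the variables x fixed, and write D = z d/dz.  A proper colouring of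
-- P (n + 1) is a walk of length n in the complete graph on the colours, so a transfer-matrix
-- recursion gives p = 1 + π p for p = Σ X (P n) z^n and π = Σ_c x_c z / (1 + x_c z); a proper
-- colouring of C n is one of P n whose end colours differ, and the closed walks have series
-- p (π - D π) + π.  Newton's identity D E = π E for E = Σ e_k z^k, with F = Σ (k - 1) e_k z^k
-- and Q = 1 / (1 - F) = Σ_J ∏ (j - 1) e_J z^|J|, then gives
--   X (P n) = [z^n] (D E · Q)  for n ≥ 1,     X (C n) = [z^n] (D F · Q)  for n ≥ 2.
-- Finally σ⁺_I(d) is the sum of the parts that follow the partial sums below d; cutting I
-- there into a prefix (weighted as in Q) and a suffix (whose first part b weighs b (b - 1),
-- as in D F) matches the σ⁺-weighted sum with Σ_k X (P k) X (C (n - k)).  The σ⁻ identity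
-- reduces to it, since σ⁻ of the reversed composition is |I| - σ⁺_I(|I| - m).

open import Data.Nat using (ℕ)
open import Data.Integer using (ℤ)
open import Data.Fin using (Fin)

module Sums where

  open import Data.Nat as ℕ using (ℕ; zero; suc; _∸_; _≤_; _<_; z≤n; s≤s)
  import Data.Nat.Properties as ℕ
  open import Data.Integer using (ℤ; +_; _+_; _*_; -_; _-_)
  import Data.Integer.Properties as ℤ
  open import Data.Fin as Fin using (Fin)
  import Data.Fin.Properties as Fin
  open import Data.Bool using (Bool; true; false; _∧_; not; if_then_else_)
  open import Data.List using (List; []; _∷_; map; concatMap; allFin; applyUpTo; _++_)
  import Data.List.Properties as List
  open import Function using (_∘_; id; _⇔_; mk⇔)
  open import Relation.Nullary using (Dec)
  open import Relation.Nullary.Decidable using (⌊_⌋; does-⇔; isYes≗does)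
  open import Relation.Binary.PropositionalEquality
  open import Algebra.Properties.CommutativeSemigroup ℤ.+-commutativeSemigroup
    using () renaming (interchange to +-interchange)
  open import Data.Integer.Tactic.RingSolver using (solve-∀)
  open import Defs using (sumℤ; sumRange)

  ∑< : ℕ → (ℕ → ℤ) → ℤ
  ∑< zero    f = + 0
  ∑< (suc k) f = f 0 + ∑< k (f ∘ suc)

  ∑<-cong< : ∀ k {f g : ℕ → ℤ} → (∀ i → i < k → f i ≡ g i) → ∑< k f ≡ ∑< k g
  ∑<-cong< zero    f≡g = refl
  ∑<-cong< (suc k) f≡g = cong₂ _+_ (f≡g 0 (s≤s z≤n)) (∑<-cong< k (λ i i<k → f≡g (suc i) (s≤s i<k)))

  ∑<-cong : ∀ k {f g : ℕ → ℤ} → f ≗ g → ∑< k f ≡ ∑< k g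
  ∑<-cong k f≗g = ∑<-cong< k (λ i _ → f≗g i)

  ∑<-+ : ∀ k f g → ∑< k (λ i → f i + g i) ≡ ∑< k f + ∑< k g
  ∑<-+ zero    f g = refl
  ∑<-+ (suc k) f g = trans (cong (_+_ (f 0 + g 0)) (∑<-+ k (f ∘ suc) (g ∘ suc))) (+-interchange (f 0) (g 0) _ _)

  ∑<-*ˡ : ∀ k c f → ∑< k (λ i → c * f i) ≡ c * ∑< k f
  ∑<-*ˡ zero    c f = sym (ℤ.*-zeroʳ c)
  ∑<-*ˡ (suc k) c f = trans (cong (_+_ (c * f 0)) (∑<-*ˡ k c (f ∘ suc))) (sym (ℤ.*-distribˡ-+ c _ _))

  ∑<-*ʳ : ∀ k f c → ∑< k (λ i → f i * c) ≡ ∑< k f * c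
  ∑<-*ʳ k f c = trans (∑<-cong k (λ i → ℤ.*-comm (f i) c)) (trans (∑<-*ˡ k c f) (ℤ.*-comm c _))

  ∑<-suc : ∀ k f → ∑< (suc k) f ≡ ∑< k f + f k
  ∑<-suc zero    f = trans (ℤ.+-identityʳ (f 0)) (sym (ℤ.+-identityˡ (f 0)))
  ∑<-suc (suc k) f = trans (cong (_+_ (f 0)) (∑<-suc k (f ∘ suc))) (sym (ℤ.+-assoc (f 0) _ _))

  ∑<-truncate : ∀ {l} k (f : ℕ → ℤ) → l ≤ k → (∀ i → l ≤ i → f i ≡ + 0) → ∑< k f ≡ ∑< l f
  ∑<-truncate {zero}  zero    f _         vanish = refl
  ∑<-truncate {zero}  (suc k) f _         vanish =
    trans (cong₂ _+_ (vanish 0 z≤n) (∑<-truncate k (f ∘ suc) z≤n (λ i _ → vanish (suc i) z≤n))) (ℤ.+-identityˡ _)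
  ∑<-truncate {suc l} (suc k) f (s≤s l≤k) vanish =
    cong (_+_ (f 0)) (∑<-truncate k (f ∘ suc) l≤k (λ i l≤i → vanish (suc i) (s≤s l≤i)))

  ∑<-triangle : ∀ k (h : ℕ → ℕ → ℤ) →
                ∑< k (λ t → ∑< (suc t) (λ b → h b (t ∸ b))) ≡ ∑< k (λ b → ∑< (k ∸ b) (h b))
  ∑<-triangle zero    h = refl
  ∑<-triangle (suc k) h = begin
    (h 0 0 + + 0) + ∑< k (λ t → h 0 (suc t) + ∑< (suc t) (λ b → h (suc b) (t ∸ b)))
      ≡⟨ cong (_+_ (h 0 0 + + 0)) (∑<-+ k (λ t → h 0 (suc t)) (λ t → ∑< (suc t) (λ b → h (suc b) (t ∸ b)))) ⟩
    (h 0 0 + + 0) + (∑< k (h 0 ∘ suc) + ∑< k (λ t → ∑< (suc t) (λ b → h (suc b) (t ∸ b))))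
      ≡⟨ cong (λ z → (h 0 0 + + 0) + (∑< k (h 0 ∘ suc) + z)) (∑<-triangle k (h ∘ suc)) ⟩
    (h 0 0 + + 0) + (∑< k (h 0 ∘ suc) + ∑< k (λ b → ∑< (k ∸ b) (h (suc b))))
      ≡⟨ cong (_+ (∑< k (h 0 ∘ suc) + ∑< k (λ b → ∑< (k ∸ b) (h (suc b))))) (ℤ.+-identityʳ (h 0 0)) ⟩
    h 0 0 + (∑< k (h 0 ∘ suc) + ∑< k (λ b → ∑< (k ∸ b) (h (suc b))))
      ≡⟨ sym (ℤ.+-assoc (h 0 0) _ _) ⟩
    (h 0 0 + ∑< k (h 0 ∘ suc)) + ∑< k (λ b → ∑< (k ∸ b) (h (suc b))) ∎
    where open ≡-Reasoning

  sumRange≡∑< : ∀ a b f → sumRange a b f ≡ ∑< (suc b ∸ a) (λ j → f (a ℕ.+ j))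
  sumRange≡∑< a b f = go (suc b ∸ a) (λ j → f (a ℕ.+ j)) (λ j → j)
    where
    go : ∀ k (g : ℕ → ℤ) h → sumℤ (map g (applyUpTo h k)) ≡ ∑< k (g ∘ h)
    go zero    g h = refl
    go (suc k) g h = cong (_+_ (g (h 0))) (go k g (h ∘ suc))

  -- The right side sums the terms n - k ≤ t ≤ n; the last one is a n * c 1 = 0 and
  -- the others become the left side under t = n - 1 - j.
  ∑<-reflect : ∀ n k (a c : ℕ → ℤ) → c 1 ≡ + 0 → suc k ≤ n →
    ∑< k (λ j → c (2 ℕ.+ j) * a (n ∸ suc j)) ≡
    ∑< (suc n) (λ t → a t * c (suc n ∸ t)) - ∑< (n ∸ k) (λ t → a t * c (suc n ∸ t))
  ∑<-reflect n zero    a c c1≡0 _ = sym (begin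
    S (suc n) - S n                          ≡⟨ cong (_- S n) (∑<-suc n (λ t → a t * c (suc n ∸ t))) ⟩
    S n + a n * c (suc n ∸ n) - S n          ≡⟨ cong (λ i → S n + a n * c i - S n) (ℕ.m+n∸n≡m 1 n) ⟩
    S n + a n * c 1 - S n                    ≡⟨ cong (λ v → S n + a n * v - S n) c1≡0 ⟩
    S n + a n * + 0 - S n                    ≡⟨ vanish (S n) (a n) ⟩
    + 0                                      ∎)
    where
    open ≡-Reasoning
    S = λ j → ∑< j (λ t → a t * c (suc n ∸ t))
    vanish : ∀ s v → s + v * + 0 - s ≡ + 0
    vanish = solve-∀
  ∑<-reflect n (suc k) a c c1≡0 1+k<n = begin
    ∑< (suc k) (λ j → c (2 ℕ.+ j) * a (n ∸ suc j))
      ≡⟨ ∑<-suc k (λ j → c (2 ℕ.+ j) * a (n ∸ suc j)) ⟩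
    ∑< k (λ j → c (2 ℕ.+ j) * a (n ∸ suc j)) + c (2 ℕ.+ k) * a i
      ≡⟨ cong (_+ c (2 ℕ.+ k) * a i) (∑<-reflect n k a c c1≡0 1+k≤n) ⟩
    S (suc n) - S (n ∸ k) + c (2 ℕ.+ k) * a i
      ≡⟨ cong (λ j → S (suc n) - S j + c (2 ℕ.+ k) * a i) (ℕ.+-∸-assoc 1 1+k≤n) ⟩
    S (suc n) - S (suc i) + c (2 ℕ.+ k) * a i
      ≡⟨ cong (λ s → S (suc n) - s + c (2 ℕ.+ k) * a i) (∑<-suc i (λ t → a t * c (suc n ∸ t))) ⟩
    S (suc n) - (S i + a i * c (suc n ∸ i)) + c (2 ℕ.+ k) * a i
      ≡⟨ cong (λ j → S (suc n) - (S i + a i * c j) + c (2 ℕ.+ k) * a i) complement ⟩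
    S (suc n) - (S i + a i * c (2 ℕ.+ k)) + c (2 ℕ.+ k) * a i
      ≡⟨ cancel (S (suc n)) (S i) (a i) (c (2 ℕ.+ k)) ⟩
    S (suc n) - S i ∎
    where
    open ≡-Reasoning
    S = λ j → ∑< j (λ t → a t * c (suc n ∸ t))
    i = n ∸ suc k
    1+k≤n : suc k ≤ n
    1+k≤n = ℕ.<⇒≤ 1+k<n
    complement : suc n ∸ i ≡ 2 ℕ.+ k
    complement = trans (ℕ.+-∸-assoc 1 (ℕ.m∸n≤m n (suc k))) (cong suc (ℕ.m∸[m∸n]≡n 1+k≤n))
    cancel : ∀ A B p q → A - (B + p * q) + q * p ≡ A - B
    cancel = solve-∀

  private variable A B : Set

  sumMap : (A → ℤ) → List A → ℤ
  sumMap g xs = sumℤ (map g xs)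

  sumMap-cong : ∀ {f g : A → ℤ} → f ≗ g → ∀ xs → sumMap f xs ≡ sumMap g xs
  sumMap-cong f≗g []       = refl
  sumMap-cong f≗g (x ∷ xs) = cong₂ _+_ (f≗g x) (sumMap-cong f≗g xs)

  sumMap-zero : ∀ xs → sumMap {A} (λ _ → + 0) xs ≡ + 0
  sumMap-zero []       = refl
  sumMap-zero (x ∷ xs) = trans (ℤ.+-identityˡ _) (sumMap-zero xs)

  sumMap-+ : ∀ (f g : A → ℤ) xs → sumMap (λ a → f a + g a) xs ≡ sumMap f xs + sumMap g xs
  sumMap-+ f g []       = refl
  sumMap-+ f g (x ∷ xs) =
    trans (cong (_+_ (f x + g x)) (sumMap-+ f g xs)) (+-interchange (f x) (g x) _ _)

  sumMap-*ˡ : ∀ c (f : A → ℤ) xs → sumMap (λ a → c * f a) xs ≡ c * sumMap f xs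
  sumMap-*ˡ c f []       = sym (ℤ.*-zeroʳ c)
  sumMap-*ˡ c f (x ∷ xs) = trans (cong (_+_ (c * f x)) (sumMap-*ˡ c f xs)) (sym (ℤ.*-distribˡ-+ c _ _))

  sumMap-neg : ∀ (f : A → ℤ) xs → sumMap (λ a → - f a) xs ≡ - sumMap f xs
  sumMap-neg f []       = refl
  sumMap-neg f (x ∷ xs) = trans (cong (_+_ (- f x)) (sumMap-neg f xs)) (sym (ℤ.neg-distrib-+ (f x) _))

  sumMap-sub : ∀ (f g : A → ℤ) xs → sumMap (λ a → f a - g a) xs ≡ sumMap f xs - sumMap g xs
  sumMap-sub f g xs = trans (sumMap-+ f (λ a → - g a) xs) (cong (_+_ (sumMap f xs)) (sumMap-neg g xs))

  sumMap-++ : ∀ (f : A → ℤ) xs ys → sumMap f (xs ++ ys) ≡ sumMap f xs + sumMap f ys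
  sumMap-++ f []       ys = sym (ℤ.+-identityˡ _)
  sumMap-++ f (x ∷ xs) ys = trans (cong (_+_ (f x)) (sumMap-++ f xs ys)) (sym (ℤ.+-assoc (f x) _ _))

  sumMap-concatMap : ∀ (f : B → ℤ) (h : A → List B) xs →
                     sumMap f (concatMap h xs) ≡ sumMap (sumMap f ∘ h) xs
  sumMap-concatMap f h []       = refl
  sumMap-concatMap f h (x ∷ xs) =
    trans (sumMap-++ f (h x) (concatMap h xs)) (cong (_+_ (sumMap f (h x))) (sumMap-concatMap f h xs))

  sumMap-map : ∀ (f : B → ℤ) (h : A → B) xs → sumMap f (map h xs) ≡ sumMap (f ∘ h) xs
  sumMap-map f h xs = cong sumℤ (sym (List.map-∘ xs))

  sumFin : ∀ N → (Fin N → ℤ) → ℤ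
  sumFin N g = sumMap g (allFin N)

  sumFin-suc : ∀ N (g : Fin (suc N) → ℤ) → sumFin (suc N) g ≡ g Fin.zero + sumFin N (g ∘ Fin.suc)
  sumFin-suc N g = cong (λ xs → g Fin.zero + sumℤ xs)
    (trans (List.map-tabulate Fin.suc g) (sym (List.map-tabulate id (g ∘ Fin.suc))))

  ⌊⌋-⇔ : {P Q : Set} → P ⇔ Q → (p? : Dec P) (q? : Dec Q) → ⌊ p? ⌋ ≡ ⌊ q? ⌋
  ⌊⌋-⇔ P⇔Q p? q? = trans (isYes≗does p?) (trans (does-⇔ P⇔Q p? q?) (sym (isYes≗does q?)))

  ≟-suc : ∀ {N} (a b : Fin N) → ⌊ Fin.suc a Fin.≟ Fin.suc b ⌋ ≡ ⌊ a Fin.≟ b ⌋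
  ≟-suc a b = ⌊⌋-⇔ (mk⇔ Fin.suc-injective (cong Fin.suc)) _ _

  infix 7.5 _when_
  _when_ : ℤ → Bool → ℤ
  w when b = if b then w else + 0

  *-when : ∀ c w b → (c * w) when b ≡ c * (w when b)
  *-when c w true  = refl
  *-when c w false = sym (ℤ.*-zeroʳ c)

  when-∧ : ∀ w a b → w when (a ∧ b) ≡ (w when b) when a
  when-∧ w true  b = refl
  when-∧ w false b = refl

  when-not-∧ : ∀ w a b → w when (not a ∧ b) ≡ w when b - w when (a ∧ b)
  when-not-∧ w true  b = sym (ℤ.+-inverseʳ (w when b))
  when-not-∧ w false b = sym (ℤ.+-identityʳ (w when b))

  sumMap-when : ∀ (f : A → ℤ) b xs → sumMap (λ a → f a when b) xs ≡ sumMap f xs when b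
  sumMap-when f true  xs = refl
  sumMap-when f false xs = sumMap-zero xs

  sumFin-select : ∀ {N} (c : Fin N) (f : Fin N → ℤ) → sumFin N (λ d → f d when ⌊ c Fin.≟ d ⌋) ≡ f c
  sumFin-select {suc N} Fin.zero f = begin
    sumFin (suc N) (λ d → f d when ⌊ Fin.zero Fin.≟ d ⌋)  ≡⟨ sumFin-suc N (λ d → f d when ⌊ Fin.zero Fin.≟ d ⌋) ⟩
    f Fin.zero + sumFin N (λ _ → + 0)                     ≡⟨ cong (_+_ (f Fin.zero)) (sumMap-zero (allFin N)) ⟩
    f Fin.zero + + 0                                      ≡⟨ ℤ.+-identityʳ _ ⟩
    f Fin.zero                                            ∎
    where open ≡-Reasoning
  sumFin-select {suc N} (Fin.suc c) f = begin
    sumFin (suc N) (λ d → f d when ⌊ Fin.suc c Fin.≟ d ⌋)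
      ≡⟨ trans (sumFin-suc N (λ d → f d when ⌊ Fin.suc c Fin.≟ d ⌋)) (ℤ.+-identityˡ _) ⟩
    sumFin N (λ d → f (Fin.suc d) when ⌊ Fin.suc c Fin.≟ Fin.suc d ⌋)
      ≡⟨ sumMap-cong (λ d → cong (f (Fin.suc d) when_) (≟-suc c d)) (allFin N) ⟩
    sumFin N (λ d → f (Fin.suc d) when ⌊ c Fin.≟ d ⌋)
      ≡⟨ sumFin-select c (f ∘ Fin.suc) ⟩
    f (Fin.suc c) ∎
    where open ≡-Reasoning

module PowerSeries where

  open import Data.Nat as ℕ using (ℕ; zero; suc; _∸_)
  open import Data.Integer using (ℤ; +_; _+_; _*_; -_; _-_)
  import Data.Integer.Properties as ℤ
  open import Relation.Binary.PropositionalEquality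
  open import Algebra.Properties.CommutativeSemigroup ℤ.+-commutativeSemigroup
    using () renaming (interchange to +-interchange; xy∙z≈xz∙y to +-right-comm)
  open import Data.Fin as Fin using (Fin)
  open import Data.List using (allFin)
  open import Function using (_∘_)
  open import Data.Integer.Tactic.RingSolver using (solve-∀)
  open Sums using (∑<; sumFin; sumFin-suc; sumMap-cong; sumMap-sub; sumMap-*ˡ)

  Series : Set
  Series = ℕ → ℤ

  shift : Series → Series
  shift f n = f (suc n)

  infixl 6 _⊕_ _⊖_
  infixl 7 _⊛_ _·_
  infix  8 ⊝_

  _⊕_ : Series → Series → Series
  (f ⊕ g) n = f n + g n

  ⊝_ : Series → Series
  (⊝ f) n = - f n

  _⊖_ : Series → Series → Series
  (f ⊖ g) n = f n - g n

  _·_ : ℤ → Series → Series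
  (c · f) n = c * f n

  𝟘 𝟙 : Series
  𝟘 _ = + 0
  𝟙 zero    = + 1
  𝟙 (suc _) = + 0

  D : Series → Series
  D f n = + n * f n

  _⊛_ : Series → Series → Series
  (f ⊛ g) zero    = f 0 * g 0
  (f ⊛ g) (suc n) = f 0 * g (suc n) + (shift f ⊛ g) n

  ⊛-as-∑< : ∀ f g n → (f ⊛ g) n ≡ ∑< (suc n) (λ i → f i * g (n ∸ i))
  ⊛-as-∑< f g zero    = sym (ℤ.+-identityʳ _)
  ⊛-as-∑< f g (suc n) = cong (_+_ (f 0 * g (suc n))) (⊛-as-∑< (shift f) g n)

  ⊛-cong : ∀ {f f′ g g′} → f ≗ f′ → g ≗ g′ → f ⊛ g ≗ f′ ⊛ g′
  ⊛-cong f≗f′ g≗g′ zero    = cong₂ _*_ (f≗f′ 0) (g≗g′ 0)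
  ⊛-cong f≗f′ g≗g′ (suc n) =
    cong₂ _+_ (cong₂ _*_ (f≗f′ 0) (g≗g′ (suc n))) (⊛-cong (λ k → f≗f′ (suc k)) g≗g′ n)

  ⊛-congˡ : ∀ {f f′ g} → f ≗ f′ → f ⊛ g ≗ f′ ⊛ g
  ⊛-congˡ f≗f′ = ⊛-cong f≗f′ (λ _ → refl)

  ⊛-congʳ : ∀ {f g g′} → g ≗ g′ → f ⊛ g ≗ f ⊛ g′
  ⊛-congʳ g≗g′ = ⊛-cong (λ _ → refl) g≗g′

  ⊛-distribʳ : ∀ f f′ g → (f ⊕ f′) ⊛ g ≗ f ⊛ g ⊕ f′ ⊛ g
  ⊛-distribʳ f f′ g zero    = ℤ.*-distribʳ-+ (g 0) (f 0) (f′ 0)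
  ⊛-distribʳ f f′ g (suc n) = begin
    (f 0 + f′ 0) * g (suc n) + ((shift f ⊕ shift f′) ⊛ g) n
      ≡⟨ cong₂ _+_ (ℤ.*-distribʳ-+ (g (suc n)) (f 0) (f′ 0)) (⊛-distribʳ (shift f) (shift f′) g n) ⟩
    (f 0 * g (suc n) + f′ 0 * g (suc n)) + ((shift f ⊛ g) n + (shift f′ ⊛ g) n)
      ≡⟨ +-interchange (f 0 * g (suc n)) _ _ _ ⟩
    (f 0 * g (suc n) + (shift f ⊛ g) n) + (f′ 0 * g (suc n) + (shift f′ ⊛ g) n) ∎
    where open ≡-Reasoning

  ·-⊛ : ∀ c f g → (c · f) ⊛ g ≗ c · (f ⊛ g)
  ·-⊛ c f g zero    = ℤ.*-assoc c (f 0) (g 0)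
  ·-⊛ c f g (suc n) =
    trans (cong₂ _+_ (ℤ.*-assoc c (f 0) (g (suc n))) (·-⊛ c (shift f) g n))
          (sym (ℤ.*-distribˡ-+ c _ _))

  ⊛-zeroˡ : ∀ g → 𝟘 ⊛ g ≗ 𝟘
  ⊛-zeroˡ g zero    = refl
  ⊛-zeroˡ g (suc n) = trans (ℤ.+-identityˡ _) (⊛-zeroˡ g n)

  ⊛-identityˡ : ∀ g → 𝟙 ⊛ g ≗ g
  ⊛-identityˡ g zero    = ℤ.*-identityˡ (g 0)
  ⊛-identityˡ g (suc n) =
    trans (cong₂ _+_ (ℤ.*-identityˡ (g (suc n))) (⊛-zeroˡ g n)) (ℤ.+-identityʳ _)

  shift-⊛ : ∀ f g → shift (f ⊛ g) ≗ shift f ⊛ g ⊕ f 0 · shift g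
  shift-⊛ f g n = ℤ.+-comm (f 0 * g (suc n)) ((shift f ⊛ g) n)

  private
    ⊛-comm-step : ∀ f g n → (shift f ⊛ g) n + f 0 * g (suc n) ≡ g 0 * f (suc n) + (f ⊛ shift g) n
    ⊛-comm-step f g zero    = cong (_+ f 0 * g 1) (ℤ.*-comm (f 1) (g 0))
    ⊛-comm-step f g (suc n) = begin
      f 1 * g (suc n) + (shift (shift f) ⊛ g) n + f 0 * g (suc (suc n))
        ≡⟨ cong (_+ f 0 * g (suc (suc n))) (ℤ.+-comm (f 1 * g (suc n)) _) ⟩
      (shift (shift f) ⊛ g) n + f 1 * g (suc n) + f 0 * g (suc (suc n))
        ≡⟨ cong (_+ f 0 * g (suc (suc n))) (⊛-comm-step (shift f) g n) ⟩
      g 0 * f (suc (suc n)) + (shift f ⊛ shift g) n + f 0 * g (suc (suc n))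
        ≡⟨ ℤ.+-assoc (g 0 * f (suc (suc n))) _ _ ⟩
      g 0 * f (suc (suc n)) + ((shift f ⊛ shift g) n + f 0 * g (suc (suc n)))
        ≡⟨ cong (_+_ (g 0 * f (suc (suc n)))) (ℤ.+-comm ((shift f ⊛ shift g) n) _) ⟩
      g 0 * f (suc (suc n)) + (f 0 * g (suc (suc n)) + (shift f ⊛ shift g) n) ∎
      where open ≡-Reasoning

  ⊛-comm : ∀ f g → f ⊛ g ≗ g ⊛ f
  ⊛-comm f g zero    = ℤ.*-comm (f 0) (g 0)
  ⊛-comm f g (suc n) = begin
    f 0 * g (suc n) + (shift f ⊛ g) n   ≡⟨ ℤ.+-comm (f 0 * g (suc n)) _ ⟩
    (shift f ⊛ g) n + f 0 * g (suc n)   ≡⟨ ⊛-comm-step f g n ⟩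
    g 0 * f (suc n) + (f ⊛ shift g) n   ≡⟨ cong (_+_ (g 0 * f (suc n))) (⊛-comm f (shift g) n) ⟩
    g 0 * f (suc n) + (shift g ⊛ f) n   ∎
    where open ≡-Reasoning

  ⊛-assoc : ∀ f g h → (f ⊛ g) ⊛ h ≗ f ⊛ (g ⊛ h)
  ⊛-assoc f g h zero    = ℤ.*-assoc (f 0) (g 0) (h 0)
  ⊛-assoc f g h (suc n) = begin
    f 0 * g 0 * h (suc n) + (shift (f ⊛ g) ⊛ h) n
      ≡⟨ cong (_+_ (f 0 * g 0 * h (suc n))) (⊛-congˡ (shift-⊛ f g) n) ⟩
    f 0 * g 0 * h (suc n) + ((shift f ⊛ g ⊕ f 0 · shift g) ⊛ h) n
      ≡⟨ cong (_+_ (f 0 * g 0 * h (suc n))) (⊛-distribʳ (shift f ⊛ g) (f 0 · shift g) h n) ⟩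
    f 0 * g 0 * h (suc n) + (((shift f ⊛ g) ⊛ h) n + ((f 0 · shift g) ⊛ h) n)
      ≡⟨ cong (_+_ (f 0 * g 0 * h (suc n))) (cong₂ _+_ (⊛-assoc (shift f) g h n) (·-⊛ (f 0) (shift g) h n)) ⟩
    f 0 * g 0 * h (suc n) + ((shift f ⊛ (g ⊛ h)) n + f 0 * (shift g ⊛ h) n)
      ≡⟨ regroup (f 0) (g 0) (h (suc n)) _ _ ⟩
    f 0 * (g 0 * h (suc n) + (shift g ⊛ h) n) + (shift f ⊛ (g ⊛ h)) n ∎
    where
    open ≡-Reasoning
    regroup : ∀ a b c d e → a * b * c + (d + a * e) ≡ a * (b * c + e) + d
    regroup = solve-∀

  shift-D : ∀ f → shift (D f) ≗ D (shift f) ⊕ shift f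
  shift-D f n = begin
    + suc n * f (suc n)              ≡⟨ cong (_* f (suc n)) (ℤ.+-comm (+ 1) (+ n)) ⟩
    (+ n + + 1) * f (suc n)          ≡⟨ ℤ.*-distribʳ-+ (f (suc n)) (+ n) (+ 1) ⟩
    + n * f (suc n) + + 1 * f (suc n) ≡⟨ cong (_+_ (+ n * f (suc n))) (ℤ.*-identityˡ _) ⟩
    + n * f (suc n) + f (suc n)      ∎
    where open ≡-Reasoning

  D-⊛ : ∀ f g → D (f ⊛ g) ≗ D f ⊛ g ⊕ f ⊛ D g
  D-⊛ f g zero    = atZero (f 0) (g 0)
    where
    atZero : ∀ a b → + 0 * (a * b) ≡ + 0 * a * b + a * (+ 0 * b)
    atZero = solve-∀
  D-⊛ f g (suc n) = begin
    + suc n * (f 0 * g (suc n) + (shift f ⊛ g) n)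
      ≡⟨ expand (+ n) (f 0) (g (suc n)) _ ⟩
    f 0 * D g (suc n) + (+ n * (shift f ⊛ g) n + (shift f ⊛ g) n)
      ≡⟨ cong (λ t → f 0 * D g (suc n) + (t + (shift f ⊛ g) n)) (D-⊛ (shift f) g n) ⟩
    f 0 * D g (suc n) + ((D (shift f) ⊛ g) n + (shift f ⊛ D g) n + (shift f ⊛ g) n)
      ≡⟨ cong (_+_ (f 0 * D g (suc n))) (+-right-comm ((D (shift f) ⊛ g) n) _ _) ⟩
    f 0 * D g (suc n) + ((D (shift f) ⊛ g) n + (shift f ⊛ g) n + (shift f ⊛ D g) n)
      ≡⟨ cong (λ t → f 0 * D g (suc n) + (t + (shift f ⊛ D g) n))
              (trans (sym (⊛-distribʳ (D (shift f)) (shift f) g n))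
                     (⊛-congˡ (λ k → sym (shift-D f k)) n)) ⟩
    f 0 * D g (suc n) + ((shift (D f) ⊛ g) n + (shift f ⊛ D g) n)
      ≡⟨ regroup (f 0) (D g (suc n)) ((shift (D f) ⊛ g) n) ((shift f ⊛ D g) n) (g (suc n)) ⟩
    (+ 0 * f 0 * g (suc n) + (shift (D f) ⊛ g) n) + (f 0 * D g (suc n) + (shift f ⊛ D g) n) ∎
    where
    open ≡-Reasoning
    expand : ∀ m a b c → (+ 1 + m) * (a * b + c) ≡ a * ((+ 1 + m) * b) + (m * c + c)
    expand = solve-∀
    regroup : ∀ a t u v b → a * t + (u + v) ≡ (+ 0 * a * b + u) + (a * t + v)
    regroup = solve-∀

  ⊛-distribˡ : ∀ f g g′ → f ⊛ (g ⊕ g′) ≗ f ⊛ g ⊕ f ⊛ g′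
  ⊛-distribˡ f g g′ n = trans (⊛-comm f (g ⊕ g′) n)
    (trans (⊛-distribʳ g g′ f n) (cong₂ _+_ (⊛-comm g f n) (⊛-comm g′ f n)))

  ⊛-identityʳ : ∀ f → f ⊛ 𝟙 ≗ f
  ⊛-identityʳ f n = trans (⊛-comm f 𝟙 n) (⊛-identityˡ f n)

  ⊛-suc : ∀ f g t → f 0 ≡ + 0 → (f ⊛ g) (suc t) ≡ (shift f ⊛ g) t
  ⊛-suc f g t f0≡0 = trans (cong (λ c → c * g (suc t) + (shift f ⊛ g) t) f0≡0) (ℤ.+-identityˡ _)

  ⊛-distribʳ-⊖ : ∀ f f′ g → (f ⊖ f′) ⊛ g ≗ f ⊛ g ⊖ f′ ⊛ g
  ⊛-distribʳ-⊖ f f′ g n = trans (⊛-distribʳ f (⊝ f′) g n) (cong (_+_ ((f ⊛ g) n)) (⊝-⊛ n))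
    where
    ⊝-⊛ : (⊝ f′) ⊛ g ≗ ⊝ (f′ ⊛ g)
    ⊝-⊛ k = trans (⊛-congˡ (λ i → sym (ℤ.-1*i≡-i (f′ i))) k)
                  (trans (·-⊛ (- + 1) f′ g k) (ℤ.-1*i≡-i _))

  ⊛-distribˡ-⊖ : ∀ f g g′ → f ⊛ (g ⊖ g′) ≗ f ⊛ g ⊖ f ⊛ g′
  ⊛-distribˡ-⊖ f g g′ n =
    trans (⊛-comm f (g ⊖ g′) n)
          (trans (⊛-distribʳ-⊖ g g′ f n) (cong₂ _-_ (⊛-comm g f n) (⊛-comm g′ f n)))

  sumˢ : ∀ N → (Fin N → Series) → Series
  sumˢ N F n = sumFin N (λ c → F c n)

  sumˢ-cong : ∀ N {F G : Fin N → Series} → (∀ c → F c ≗ G c) → sumˢ N F ≗ sumˢ N G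
  sumˢ-cong N F≗G n = sumMap-cong (λ c → F≗G c n) (allFin N)

  ⊛-sumˢ : ∀ N (F : Fin N → Series) g → sumˢ N F ⊛ g ≗ sumˢ N (λ c → F c ⊛ g)
  ⊛-sumˢ zero    F g n = ⊛-zeroˡ g n
  ⊛-sumˢ (suc N) F g n = begin
    (sumˢ (suc N) F ⊛ g) n
      ≡⟨ ⊛-congˡ (λ k → sumFin-suc N (λ c → F c k)) n ⟩
    ((F Fin.zero ⊕ sumˢ N (F ∘ Fin.suc)) ⊛ g) n
      ≡⟨ ⊛-distribʳ (F Fin.zero) _ g n ⟩
    (F Fin.zero ⊛ g) n + (sumˢ N (F ∘ Fin.suc) ⊛ g) n
      ≡⟨ cong (_+_ ((F Fin.zero ⊛ g) n)) (⊛-sumˢ N (F ∘ Fin.suc) g n) ⟩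
    (F Fin.zero ⊛ g) n + sumˢ N (λ c → F (Fin.suc c) ⊛ g) n
      ≡⟨ sym (sumFin-suc N (λ c → (F c ⊛ g) n)) ⟩
    sumˢ (suc N) (λ c → F c ⊛ g) n ∎
    where open ≡-Reasoning

  sumˢ-⊖ : ∀ N (F G : Fin N → Series) → sumˢ N (λ c → F c ⊖ G c) ≗ sumˢ N F ⊖ sumˢ N G
  sumˢ-⊖ N F G n = sumMap-sub (λ c → F c n) (λ c → G c n) (allFin N)

  sumˢ-D : ∀ N (F : Fin N → Series) → sumˢ N (D ∘ F) ≗ D (sumˢ N F)
  sumˢ-D N F n = sumMap-*ˡ (+ n) (λ c → F c n) (allFin N)

  one-minus-⊛ : ∀ a s b → s ≗ b ⊕ a ⊛ s → (𝟙 ⊖ a) ⊛ s ≗ b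
  one-minus-⊛ a s b s-eq n = begin
    ((𝟙 ⊖ a) ⊛ s) n             ≡⟨ ⊛-distribʳ-⊖ 𝟙 a s n ⟩
    (𝟙 ⊛ s) n - (a ⊛ s) n       ≡⟨ cong₂ _-_ (trans (⊛-identityˡ s n) (s-eq n)) refl ⟩
    b n + (a ⊛ s) n - (a ⊛ s) n ≡⟨ cancel (b n) ((a ⊛ s) n) ⟩
    b n                         ∎
    where
    open ≡-Reasoning
    cancel : ∀ x y → x + y - y ≡ x
    cancel = solve-∀

  inverse-solves : ∀ a a⁻¹ s b → a ⊛ a⁻¹ ≗ 𝟙 → a ⊛ s ≗ b → s ≗ a⁻¹ ⊛ b
  inverse-solves a a⁻¹ s b inverse as≗b n = begin
    s n                   ≡⟨ sym (⊛-identityˡ s n) ⟩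
    (𝟙 ⊛ s) n             ≡⟨ ⊛-congˡ (λ k → sym (trans (⊛-comm a⁻¹ a k) (inverse k))) n ⟩
    ((a⁻¹ ⊛ a) ⊛ s) n     ≡⟨ ⊛-assoc a⁻¹ a s n ⟩
    (a⁻¹ ⊛ (a ⊛ s)) n     ≡⟨ ⊛-congʳ as≗b n ⟩
    (a⁻¹ ⊛ b) n           ∎
    where open ≡-Reasoning

  geometric-unique : ∀ π p → p ≗ 𝟙 ⊕ π ⊛ p → ∀ s b → s ≗ b ⊕ π ⊛ s → s ≗ p ⊛ b
  geometric-unique π p p-eq s b s-eq =
    inverse-solves (𝟙 ⊖ π) p s b (one-minus-⊛ π p 𝟙 p-eq) (one-minus-⊛ π s b s-eq)

  -- (1 - π) p = 1, (1 - π) E = E - D E = 1 - F and (1 - F) Q = 1 force p = E Q.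
  module PathCycleSeries (π E F Q p : Series)
    (p-eq : p ≗ 𝟙 ⊕ π ⊛ p) (newton : D E ≗ π ⊛ E)
    (Q-eq : Q ≗ 𝟙 ⊕ F ⊛ Q) (F-eq : F ≗ D E ⊖ E ⊕ 𝟙) where

    private
      DE≗E⊖[𝟙⊖F] : D E ≗ E ⊖ (𝟙 ⊖ F)
      DE≗E⊖[𝟙⊖F] n = trans (rearrange (D E n) (E n) (𝟙 n)) (cong (λ t → E n - (𝟙 n - t)) (sym (F-eq n)))
        where
        rearrange : ∀ d e o → d ≡ e - (o - (d - e + o))
        rearrange = solve-∀

      [𝟙⊖π]⊛E : (𝟙 ⊖ π) ⊛ E ≗ 𝟙 ⊖ F
      [𝟙⊖π]⊛E n = begin
        ((𝟙 ⊖ π) ⊛ E) n            ≡⟨ ⊛-distribʳ-⊖ 𝟙 π E n ⟩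
        (𝟙 ⊛ E) n - (π ⊛ E) n      ≡⟨ cong₂ _-_ (⊛-identityˡ E n) (sym (newton n)) ⟩
        E n - D E n                ≡⟨ cong (_-_ (E n)) (DE≗E⊖[𝟙⊖F] n) ⟩
        E n - (E n - (𝟙 n - F n))  ≡⟨ cancel (E n) (𝟙 n - F n) ⟩
        𝟙 n - F n                  ∎
        where
        open ≡-Reasoning
        cancel : ∀ e t → e - (e - t) ≡ t
        cancel = solve-∀

      [𝟙⊖F]⊛Q : (𝟙 ⊖ F) ⊛ Q ≗ 𝟙
      [𝟙⊖F]⊛Q = one-minus-⊛ F Q 𝟙 Q-eq

    p≗E⊛Q : p ≗ E ⊛ Q
    p≗E⊛Q n = trans (sym (⊛-identityʳ p n))
      (sym (inverse-solves (𝟙 ⊖ π) p (E ⊛ Q) 𝟙 (one-minus-⊛ π p 𝟙 p-eq)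
        (λ k → trans (sym (⊛-assoc (𝟙 ⊖ π) E Q k)) (trans (⊛-congˡ [𝟙⊖π]⊛E k) ([𝟙⊖F]⊛Q k))) n))

    DE⊛Q : D E ⊛ Q ≗ p ⊖ 𝟙
    DE⊛Q n = begin
      (D E ⊛ Q) n                     ≡⟨ ⊛-congˡ DE≗E⊖[𝟙⊖F] n ⟩
      ((E ⊖ (𝟙 ⊖ F)) ⊛ Q) n           ≡⟨ ⊛-distribʳ-⊖ E (𝟙 ⊖ F) Q n ⟩
      (E ⊛ Q) n - ((𝟙 ⊖ F) ⊛ Q) n     ≡⟨ cong₂ _-_ (sym (p≗E⊛Q n)) ([𝟙⊖F]⊛Q n) ⟩
      p n - 𝟙 n                       ∎
      where open ≡-Reasoning

    path-formula : p ≗ D E ⊛ Q ⊕ 𝟙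
    path-formula n = sym (trans (cong (_+ 𝟙 n) (DE⊛Q n)) (cancel (p n) (𝟙 n)))
      where
      cancel : ∀ x y → x - y + y ≡ x
      cancel = solve-∀

    π⊛p : π ⊛ p ≗ p ⊖ 𝟙
    π⊛p n = trans (sym (cancel (𝟙 n) ((π ⊛ p) n))) (cong (_- 𝟙 n) (sym (p-eq n)))
      where
      cancel : ∀ x y → x + y - x ≡ y
      cancel = solve-∀

    private
      DF≗DDE⊖DE : D F ≗ D (D E) ⊖ D E
      DF≗DDE⊖DE zero    = refl
      DF≗DDE⊖DE (suc k) = trans (cong (+ suc k *_) (F-eq (suc k)))
                                (distribute (+ suc k) (D E (suc k)) (E (suc k)))
        where
        distribute : ∀ m d e → m * (d - e + + 0) ≡ m * d - m * e
        distribute = solve-∀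

      DDE : D (D E) ≗ D π ⊛ E ⊕ π ⊛ D E
      DDE k = trans (cong (+ k *_) (newton k)) (D-⊛ π E k)

    DF⊛Q : D F ⊛ Q ≗ p ⊛ D π ⊖ π
    DF⊛Q n = begin
      (D F ⊛ Q) n
        ≡⟨ ⊛-congˡ DF≗DDE⊖DE n ⟩
      ((D (D E) ⊖ D E) ⊛ Q) n
        ≡⟨ ⊛-distribʳ-⊖ (D (D E)) (D E) Q n ⟩
      (D (D E) ⊛ Q) n - (D E ⊛ Q) n
        ≡⟨ cong₂ _-_ (trans (⊛-congˡ DDE n) (⊛-distribʳ (D π ⊛ E) (π ⊛ D E) Q n)) (DE⊛Q n) ⟩
      ((D π ⊛ E) ⊛ Q) n + ((π ⊛ D E) ⊛ Q) n - (p n - 𝟙 n)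
        ≡⟨ cong (λ t → t - (p n - 𝟙 n)) (cong₂ _+_ Dπ-term π-term) ⟩
      (p ⊛ D π) n + (p n - 𝟙 n - π n) - (p n - 𝟙 n)
        ≡⟨ cancel ((p ⊛ D π) n) (p n - 𝟙 n) (π n) ⟩
      (p ⊛ D π) n - π n ∎
      where
      open ≡-Reasoning
      cancel : ∀ d a q → d + (a - q) - a ≡ d - q
      cancel = solve-∀
      Dπ-term : ((D π ⊛ E) ⊛ Q) n ≡ (p ⊛ D π) n
      Dπ-term = trans (⊛-assoc (D π) E Q n)
                      (trans (⊛-congʳ (λ k → sym (p≗E⊛Q k)) n) (⊛-comm (D π) p n))
      π-term : ((π ⊛ D E) ⊛ Q) n ≡ p n - 𝟙 n - π n
      π-term = begin
        ((π ⊛ D E) ⊛ Q) n      ≡⟨ ⊛-assoc π (D E) Q n ⟩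
        (π ⊛ (D E ⊛ Q)) n      ≡⟨ ⊛-congʳ DE⊛Q n ⟩
        (π ⊛ (p ⊖ 𝟙)) n        ≡⟨ ⊛-distribˡ-⊖ π p 𝟙 n ⟩
        (π ⊛ p) n - (π ⊛ 𝟙) n  ≡⟨ cong₂ _-_ (π⊛p n) (⊛-identityʳ π n) ⟩
        p n - 𝟙 n - π n        ∎

    cycle-formula : p ⊖ (p ⊛ (π ⊖ D π) ⊕ π) ≗ 𝟙 ⊕ D F ⊛ Q
    cycle-formula n = begin
      p n - ((p ⊛ (π ⊖ D π)) n + π n)
        ≡⟨ cong (λ t → p n - (t + π n)) (⊛-distribˡ-⊖ p π (D π) n) ⟩
      p n - ((p ⊛ π) n - (p ⊛ D π) n + π n)
        ≡⟨ cong (λ t → p n - (t - (p ⊛ D π) n + π n)) (trans (⊛-comm p π n) (π⊛p n)) ⟩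
      p n - (p n - 𝟙 n - (p ⊛ D π) n + π n)
        ≡⟨ rearrange (p n) (𝟙 n) ((p ⊛ D π) n) (π n) ⟩
      𝟙 n + ((p ⊛ D π) n - π n)
        ≡⟨ cong (_+_ (𝟙 n)) (sym (DF⊛Q n)) ⟩
      𝟙 n + (D F ⊛ Q) n ∎
      where
      open ≡-Reasoning
      rearrange : ∀ a o d q → a - (a - o - d + q) ≡ o + (d - q)
      rearrange = solve-∀

module Newton where

  open import Data.Nat using (zero; suc)
  open import Data.Integer using (ℤ; +_; _+_; _*_; -_; _-_)
  import Data.Integer.Properties as ℤ
  open import Data.Fin as Fin using (Fin)
  open import Data.List using (allFin)
  import Data.Vec.Functional as Vec
  open import Function using (_∘_)
  open import Relation.Binary.PropositionalEquality
  open import Data.Integer.Tactic.RingSolver using (solve-∀)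
  open import Defs using (e)
  open Sums
  open PowerSeries

  -- u y = y z / (1 + y z) = Σ_{j ≥ 1} (-1)^(j-1) y^j z^j
  u : ℤ → Series
  u y zero          = + 0
  u y (suc zero)    = y
  u y (suc (suc j)) = - (y * u y (suc j))

  shift-u : ∀ y → shift (u y) ≗ y · (𝟙 ⊖ u y)
  shift-u y zero    = sym (trans (cong (y *_) (ℤ.+-identityʳ (+ 1))) (ℤ.*-identityʳ y))
  shift-u y (suc j) = trans (ℤ.neg-distribʳ-* y _) (cong (y *_) (sym (ℤ.+-identityˡ _)))

  u-square : ∀ y → u y ⊛ u y ≗ u y ⊖ D (u y)
  u-square y zero    = refl
  u-square y (suc m) = begin
    + 0 * u y (suc m) + (shift (u y) ⊛ u y) m
      ≡⟨ cong (_+_ (+ 0 * u y (suc m))) (begin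
           (shift (u y) ⊛ u y) m                   ≡⟨ ⊛-congˡ (shift-u y) m ⟩
           ((y · (𝟙 ⊖ u y)) ⊛ u y) m               ≡⟨ ·-⊛ y (𝟙 ⊖ u y) (u y) m ⟩
           y * ((𝟙 ⊖ u y) ⊛ u y) m                 ≡⟨ cong (y *_) (⊛-distribʳ-⊖ 𝟙 (u y) (u y) m) ⟩
           y * ((𝟙 ⊛ u y) m - (u y ⊛ u y) m)       ≡⟨ cong (y *_) (cong₂ _-_ (⊛-identityˡ (u y) m) (u-square y m)) ⟩
           y * (u y m - (u y m - + m * u y m))     ∎) ⟩
    + 0 * u y (suc m) + y * (u y m - (u y m - + m * u y m))
      ≡⟨ last m ⟩
    u y (suc m) - + suc m * u y (suc m) ∎
    where
    open ≡-Reasoning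
    last : ∀ m → + 0 * u y (suc m) + y * (u y m - (u y m - + m * u y m)) ≡ u y (suc m) - + suc m * u y (suc m)
    last zero    = atOne y
      where atOne : ∀ y → + 0 * y + y * (+ 0 - (+ 0 - + 0 * + 0)) ≡ y - + 1 * y
            atOne = solve-∀
    last (suc k) = beyond y (+ k) (u y (suc k))
      where beyond : ∀ y k a → + 0 * - (y * a) + y * (a - (a - (+ 1 + k) * a)) ≡ - (y * a) - (+ 1 + (+ 1 + k)) * - (y * a)
            beyond = solve-∀

  E : ∀ {N} → (Fin N → ℤ) → Series
  E x k = e k x

  -- π = z E′ / E, the series Σ_{k ≥ 1} (-1)^(k-1) p_k z^k of signed power sums.
  π : ∀ {N} → (Fin N → ℤ) → Series
  π {N} x = sumˢ N (u ∘ x)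

  linearFactor : ℤ → Series
  linearFactor y zero          = + 1
  linearFactor y (suc zero)    = y
  linearFactor y (suc (suc _)) = + 0

  shift-linearFactor : ∀ y → shift (linearFactor y) ≗ y · 𝟙
  shift-linearFactor y zero    = sym (ℤ.*-identityʳ y)
  shift-linearFactor y (suc _) = sym (ℤ.*-zeroʳ y)

  E-tail : ∀ {N} (x : Fin (suc N) → ℤ) → E x ≗ linearFactor (x Fin.zero) ⊛ E (Vec.tail x)
  E-tail x zero    = refl
  E-tail x (suc k) = begin
    e (suc k) x′ + y * e k x′
      ≡⟨ cong₂ _+_ (sym (ℤ.*-identityˡ (e (suc k) x′))) (cong (y *_) (sym (⊛-identityˡ (E x′) k))) ⟩
    + 1 * e (suc k) x′ + y * (𝟙 ⊛ E x′) k
      ≡⟨ cong (_+_ (+ 1 * e (suc k) x′)) (sym (trans (⊛-congˡ (shift-linearFactor y) k)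
                                                     (·-⊛ y 𝟙 (E x′) k))) ⟩
    + 1 * e (suc k) x′ + (shift (linearFactor y) ⊛ E x′) k ∎
    where
    open ≡-Reasoning
    y  = x Fin.zero
    x′ = Vec.tail x

  u-linearFactor : ∀ y → u y ⊛ linearFactor y ≗ D (linearFactor y)
  u-linearFactor y n = trans (⊛-comm (u y) (linearFactor y) n) (product n)
    where
    product : ∀ n → (linearFactor y ⊛ u y) n ≡ D (linearFactor y) n
    product zero          = refl
    product (suc zero)    = begin
      + 1 * y + (shift (linearFactor y) ⊛ u y) 0  ≡⟨ cong₂ _+_ (ℤ.*-identityˡ y) (ℤ.*-zeroʳ y) ⟩
      y + + 0                                      ≡⟨ ℤ.+-identityʳ y ⟩
      y                                            ≡⟨ sym (ℤ.*-identityˡ y) ⟩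
      + 1 * y                                      ∎
      where open ≡-Reasoning
    product (suc (suc k)) = begin
      + 1 * - (y * u y (suc k)) + (shift (linearFactor y) ⊛ u y) (suc k)
        ≡⟨ cong (_+_ (+ 1 * - (y * u y (suc k)))) (⊛-congˡ (shift-linearFactor y) (suc k)) ⟩
      + 1 * - (y * u y (suc k)) + ((y · 𝟙) ⊛ u y) (suc k)
        ≡⟨ cong (_+_ (+ 1 * - (y * u y (suc k)))) (trans (·-⊛ y 𝟙 (u y) (suc k)) (cong (y *_) (⊛-identityˡ (u y) (suc k)))) ⟩
      + 1 * - (y * u y (suc k)) + y * u y (suc k)
        ≡⟨ cancel y (u y (suc k)) (+ (suc (suc k))) ⟩
      + suc (suc k) * + 0 ∎
      where
      open ≡-Reasoning
      cancel : ∀ y a n → + 1 * - (y * a) + y * a ≡ n * + 0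
      cancel = solve-∀

  newton : ∀ N (x : Fin N → ℤ) → D (E x) ≗ π x ⊛ E x
  newton zero    x n = trans (no-variables n) (sym (⊛-zeroˡ (E x) n))
    where
    no-variables : D (E x) ≗ 𝟘
    no-variables zero    = refl
    no-variables (suc n) = ℤ.*-zeroʳ (+ suc n)
  newton (suc N) x = λ n → begin
    D (E x) n                                       ≡⟨ cong (+ n *_) (E-tail x n) ⟩
    D (ℓ ⊛ E x′) n                                  ≡⟨ D-⊛ ℓ (E x′) n ⟩
    (D ℓ ⊛ E x′) n + (ℓ ⊛ D (E x′)) n               ≡⟨ cong₂ _+_ (⊛-congˡ (λ k → sym (u-linearFactor y k)) n)
                                                               (⊛-congʳ (newton N x′) n) ⟩
    ((u y ⊛ ℓ) ⊛ E x′) n + (ℓ ⊛ (π x′ ⊛ E x′)) n    ≡⟨ cong₂ _+_ (⊛-assoc (u y) ℓ (E x′) n) (reorder n) ⟩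
    (u y ⊛ (ℓ ⊛ E x′)) n + (π x′ ⊛ (ℓ ⊛ E x′)) n    ≡⟨ sym (⊛-distribʳ (u y) (π x′) (ℓ ⊛ E x′) n) ⟩
    ((u y ⊕ π x′) ⊛ (ℓ ⊛ E x′)) n                   ≡⟨ ⊛-cong (λ k → sym (sumFin-suc N (λ c → u (x c) k)))
                                                              (λ k → sym (E-tail x k)) n ⟩
    (π x ⊛ E x) n                                   ∎
    where
    open ≡-Reasoning
    y  = x Fin.zero
    x′ = Vec.tail x
    ℓ  = linearFactor y
    reorder : ℓ ⊛ (π x′ ⊛ E x′) ≗ π x′ ⊛ (ℓ ⊛ E x′)
    reorder k = trans (sym (⊛-assoc ℓ (π x′) (E x′) k))
                      (trans (⊛-congˡ (⊛-comm ℓ (π x′)) k) (⊛-assoc (π x′) ℓ (E x′) k))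

module Colourings where

  open import Data.Nat as ℕ using (ℕ; zero; suc)
  import Data.Nat.Properties as ℕ
  open import Data.Fin as Fin using (Fin; toℕ)
  import Data.Fin.Properties as Fin
  open import Data.Bool using (Bool; true; false; _∧_; _∨_; not)
  import Data.Bool.Properties as Bool
  open import Data.Bool.ListAction using (and; all)
  open import Data.List using (List; []; _∷_; map; concatMap; allFin)
  import Data.List.Properties as List
  import Data.Vec.Functional as Vec
  open import Algebra.Bundles using (CommutativeMonoid)
  open import Algebra.Properties.CommutativeSemigroup
    (CommutativeMonoid.commutativeSemigroup Bool.∧-commutativeMonoid)
    using () renaming (interchange to ∧-interchange)
  open import Function using (_∘_; id; mk⇔)
  open import Relation.Nullary.Decidable using (⌊_⌋; isYes≗does; dec-true)
  open import Relation.Binary.PropositionalEquality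
  open import Defs
  open Sums using (⌊⌋-⇔)

  private variable A : Set

  ==-suc : ∀ m n → (suc m == suc n) ≡ (m == n)
  ==-suc m n = ⌊⌋-⇔ (mk⇔ ℕ.suc-injective (cong suc)) _ _

  ==-sym : ∀ m n → (m == n) ≡ (n == m)
  ==-sym m n = ⌊⌋-⇔ (mk⇔ sym sym) _ _

  ≟-sym : ∀ {N} (a b : Fin N) → ⌊ a Fin.≟ b ⌋ ≡ ⌊ b Fin.≟ a ⌋
  ≟-sym a b = ⌊⌋-⇔ (mk⇔ sym sym) _ _

  ≟-refl : ∀ {N} (a : Fin N) → ⌊ a Fin.≟ a ⌋ ≡ true
  ≟-refl a = trans (isYes≗does (a Fin.≟ a)) (dec-true (a Fin.≟ a) refl)

  all-cong : ∀ {p q : A → Bool} → (∀ a → p a ≡ q a) → ∀ xs → all p xs ≡ all q xs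
  all-cong p≗q xs = cong and (List.map-cong p≗q xs)

  all-true : ∀ (xs : List A) → all (λ _ → true) xs ≡ true
  all-true []       = refl
  all-true (x ∷ xs) = all-true xs

  all-∧ : ∀ (p q : A → Bool) xs → all (λ a → p a ∧ q a) xs ≡ all p xs ∧ all q xs
  all-∧ p q []       = refl
  all-∧ p q (x ∷ xs) = trans (cong (_∧_ (p x ∧ q x)) (all-∧ p q xs)) (∧-interchange (p x) (q x) _ _)

  all-∨ˡ : ∀ b (p : A → Bool) xs → all (λ a → b ∨ p a) xs ≡ b ∨ all p xs
  all-∨ˡ true  p xs = all-true xs
  all-∨ˡ false p xs = refl

  all-allFin-suc : ∀ V (p : Fin (suc V) → Bool) → all p (allFin (suc V)) ≡ p Fin.zero ∧ all (p ∘ Fin.suc) (allFin V)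
  all-allFin-suc V p = cong (λ bs → p Fin.zero ∧ and bs)
    (trans (List.map-tabulate Fin.suc p) (sym (List.map-tabulate id (p ∘ Fin.suc))))

  all-at : ∀ V (i : Fin V) (q : Fin V → Bool) → all (λ j → not (toℕ j == toℕ i) ∨ q j) (allFin V) ≡ q i
  all-at (suc V) Fin.zero    q = begin
    all (λ j → not (toℕ j == 0) ∨ q j) (allFin (suc V))   ≡⟨ all-allFin-suc V _ ⟩
    q Fin.zero ∧ all (λ _ → true) (allFin V)              ≡⟨ cong (q Fin.zero ∧_) (all-true (allFin V)) ⟩
    q Fin.zero ∧ true                                     ≡⟨ Bool.∧-identityʳ _ ⟩
    q Fin.zero                                            ∎
    where open ≡-Reasoning
  all-at (suc V) (Fin.suc i) q = begin
    all (λ j → not (toℕ j == suc (toℕ i)) ∨ q j) (allFin (suc V))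
      ≡⟨ all-allFin-suc V (λ j → not (toℕ j == suc (toℕ i)) ∨ q j) ⟩
    all (λ j → not (suc (toℕ j) == suc (toℕ i)) ∨ q (Fin.suc j)) (allFin V)
      ≡⟨ all-cong (λ j → cong (λ b → not b ∨ q (Fin.suc j)) (==-suc (toℕ j) (toℕ i))) (allFin V) ⟩
    all (λ j → not (toℕ j == toℕ i) ∨ q (Fin.suc j)) (allFin V)
      ≡⟨ all-at V i (q ∘ Fin.suc) ⟩
    q (Fin.suc i) ∎
    where open ≡-Reasoning

  edge : ∀ {V} → Fin V → Fin V → Fin V → Fin V → Bool
  edge s t i j = (toℕ i == toℕ s) ∧ (toℕ j == toℕ t)

  graph : ∀ {V} → (Fin V → Fin V → Bool) → Graph
  graph {V} a = record { V = V ; adj = a }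

  module _ {V N : ℕ} where

    differ : (Fin V → Fin N) → Fin V → Fin V → Bool
    differ κ i j = not ⌊ κ i Fin.≟ κ j ⌋

    proper-as-all : ∀ (a : Fin V → Fin V → Bool) κ →
      proper (graph a) κ ≡ all (λ i → all (λ j → not (a i j) ∨ differ κ i j) (allFin V)) (allFin V)
    proper-as-all a κ = go (allFin V)
      where
      go : ∀ is → and (concatMap (λ i → map (λ j → not (a i j) ∨ differ κ i j) (allFin V)) is)
                  ≡ all (λ i → all (λ j → not (a i j) ∨ differ κ i j) (allFin V)) is
      go []       = refl
      go (i ∷ is) = trans (List.foldr-++ _∧_ true (map _ (allFin V)) _)
                          (trans (foldr-∧ (map _ (allFin V)) _) (cong (all _ (allFin V) ∧_) (go is)))
        where
        foldr-∧ : ∀ bs b → Data.List.foldr _∧_ b bs ≡ and bs ∧ b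
        foldr-∧ []       b = refl
        foldr-∧ (c ∷ bs) b = trans (cong (c ∧_) (foldr-∧ bs b)) (sym (Bool.∧-assoc c _ b))

    proper-cong : ∀ {a b : Fin V → Fin V → Bool} → (∀ i j → a i j ≡ b i j) → ∀ κ →
                  proper (graph a) κ ≡ proper (graph b) κ
    proper-cong a≡b κ = trans (proper-as-all _ κ) (trans
      (all-cong (λ i → all-cong (λ j → cong (λ c → not c ∨ differ κ i j) (a≡b i j)) (allFin V)) (allFin V))
      (sym (proper-as-all _ κ)))

    proper-∪ : ∀ (a b : Fin V → Fin V → Bool) κ →
               proper (graph (λ i j → a i j ∨ b i j)) κ ≡ proper (graph a) κ ∧ proper (graph b) κ
    proper-∪ a b κ = begin
      proper (graph (λ i j → a i j ∨ b i j)) κ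
        ≡⟨ proper-as-all _ κ ⟩
      all (λ i → all (λ j → not (a i j ∨ b i j) ∨ differ κ i j) (allFin V)) (allFin V)
        ≡⟨ all-cong (λ i → trans (all-cong (λ j → split (a i j) (b i j) (differ κ i j)) (allFin V))
                                 (all-∧ _ _ (allFin V))) (allFin V) ⟩
      all (λ i → all (λ j → not (a i j) ∨ differ κ i j) (allFin V) ∧ all (λ j → not (b i j) ∨ differ κ i j) (allFin V)) (allFin V)
        ≡⟨ all-∧ _ _ (allFin V) ⟩
      all (λ i → all (λ j → not (a i j) ∨ differ κ i j) (allFin V)) (allFin V) ∧
      all (λ i → all (λ j → not (b i j) ∨ differ κ i j) (allFin V)) (allFin V)
        ≡⟨ sym (cong₂ _∧_ (proper-as-all a κ) (proper-as-all b κ)) ⟩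
      proper (graph a) κ ∧ proper (graph b) κ ∎
      where
      open ≡-Reasoning
      split : ∀ x y z → not (x ∨ y) ∨ z ≡ (not x ∨ z) ∧ (not y ∨ z)
      split false y z     = refl
      split true  y false = refl
      split true  y true  = sym (Bool.∨-zeroʳ (not y))

    proper-edge : ∀ s t κ → proper (graph (edge s t)) κ ≡ differ κ s t
    proper-edge s t κ = begin
      proper (graph (edge s t)) κ
        ≡⟨ proper-as-all _ κ ⟩
      all (λ i → all (λ j → not (edge s t i j) ∨ differ κ i j) (allFin V)) (allFin V)
        ≡⟨ all-cong (λ i → trans (all-cong (λ j → curry (toℕ i == toℕ s) (toℕ j == toℕ t) (differ κ i j)) (allFin V))
                                 (all-∨ˡ (not (toℕ i == toℕ s)) _ (allFin V))) (allFin V) ⟩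
      all (λ i → not (toℕ i == toℕ s) ∨ all (λ j → not (toℕ j == toℕ t) ∨ differ κ i j) (allFin V)) (allFin V)
        ≡⟨ all-cong (λ i → cong (not (toℕ i == toℕ s) ∨_) (all-at V t (differ κ i))) (allFin V) ⟩
      all (λ i → not (toℕ i == toℕ s) ∨ differ κ i t) (allFin V)
        ≡⟨ all-at V s (λ i → differ κ i t) ⟩
      differ κ s t ∎
      where
      open ≡-Reasoning
      curry : ∀ x y z → not (x ∧ y) ∨ z ≡ not x ∨ (not y ∨ z)
      curry false y z = refl
      curry true  y z = refl

  liftAdj : ∀ {V} → (Fin V → Fin V → Bool) → Fin (suc V) → Fin (suc V) → Bool
  liftAdj a (Fin.suc i) (Fin.suc j) = a i j
  liftAdj a _           _           = false

  proper-liftAdj : ∀ {V N} (a : Fin V → Fin V → Bool) (c : Fin N) κ →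
                   proper (graph (liftAdj a)) (c Vec.∷ κ) ≡ proper (graph a) κ
  proper-liftAdj {V} a c κ = begin
    proper (graph (liftAdj a)) (c Vec.∷ κ)
      ≡⟨ proper-as-all (liftAdj a) (c Vec.∷ κ) ⟩
    all row (allFin (suc V))
      ≡⟨ all-allFin-suc V row ⟩
    row Fin.zero ∧ all (row ∘ Fin.suc) (allFin V)
      ≡⟨ cong₂ _∧_ (all-true (allFin (suc V))) (all-cong (λ i → all-allFin-suc V (entry (Fin.suc i))) (allFin V)) ⟩
    all (λ i → all (λ j → not (a i j) ∨ differ κ i j) (allFin V)) (allFin V)
      ≡⟨ sym (proper-as-all a κ) ⟩
    proper (graph a) κ ∎
    where
    open ≡-Reasoning
    entry : Fin (suc V) → Fin (suc V) → Bool
    entry i j = not (liftAdj a i j) ∨ differ (c Vec.∷ κ) i j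
    row : Fin (suc V) → Bool
    row i = all (entry i) (allFin (suc V))

  private
    0F 1F : ∀ {n} → Fin (suc (suc n))
    0F = Fin.zero
    1F = Fin.suc Fin.zero

  differ-both-ways : ∀ {N} (a b : Fin N) → not ⌊ a Fin.≟ b ⌋ ∧ not ⌊ b Fin.≟ a ⌋ ≡ not ⌊ a Fin.≟ b ⌋
  differ-both-ways a b = trans (cong (λ d → not ⌊ a Fin.≟ b ⌋ ∧ not d) (≟-sym b a)) (Bool.∧-idem _)

  path-adj : ∀ n i j → adj (P (suc (suc n))) i j ≡ (edge 0F 1F i j ∨ edge 1F 0F i j) ∨ liftAdj (adj (P (suc n))) i j
  path-adj n Fin.zero    Fin.zero    = refl
  path-adj n Fin.zero    (Fin.suc j) =
    cong (_∨ false) (trans (==-sym 1 (suc (toℕ j))) (sym (Bool.∨-identityʳ _)))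
  path-adj n (Fin.suc i) Fin.zero    =
    trans (==-sym 1 (suc (toℕ i)))
          (sym (trans (Bool.∨-identityʳ _) (Bool.∧-identityʳ _)))
  path-adj n (Fin.suc i) (Fin.suc j) =
    trans (cong₂ _∨_ (==-suc (suc (toℕ i)) (toℕ j)) (==-suc (suc (toℕ j)) (toℕ i)))
          (cong (_∨ adj (P (suc n)) i j) (sym (Bool.∧-zeroʳ (suc (toℕ i) == 1))))

  proper-P-∷ : ∀ {N} n (c : Fin N) (κ : Fin (suc n) → Fin N) →
               proper (P (suc (suc n))) (c Vec.∷ κ) ≡ not ⌊ c Fin.≟ κ Fin.zero ⌋ ∧ proper (P (suc n)) κ
  proper-P-∷ n c κ = begin
    proper (P (suc (suc n))) (c Vec.∷ κ)
      ≡⟨ proper-cong (path-adj n) (c Vec.∷ κ) ⟩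
    proper (graph (λ i j → (edge 0F 1F i j ∨ edge 1F 0F i j) ∨ liftAdj (adj (P (suc n))) i j)) (c Vec.∷ κ)
      ≡⟨ proper-∪ (λ i j → edge 0F 1F i j ∨ edge 1F 0F i j) (liftAdj (adj (P (suc n)))) (c Vec.∷ κ) ⟩
    proper (graph (λ i j → edge 0F 1F i j ∨ edge 1F 0F i j)) (c Vec.∷ κ) ∧ proper (graph (liftAdj (adj (P (suc n))))) (c Vec.∷ κ)
      ≡⟨ cong₂ _∧_ (proper-∪ (edge 0F 1F) (edge 1F 0F) (c Vec.∷ κ)) (proper-liftAdj (adj (P (suc n))) c κ) ⟩
    (proper (graph (edge 0F 1F)) (c Vec.∷ κ) ∧ proper (graph (edge 1F 0F)) (c Vec.∷ κ)) ∧ proper (P (suc n)) κ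
      ≡⟨ cong (_∧ proper (P (suc n)) κ) (cong₂ _∧_ (proper-edge 0F 1F (c Vec.∷ κ)) (proper-edge 1F 0F (c Vec.∷ κ))) ⟩
    (differ (c Vec.∷ κ) 0F 1F ∧ differ (c Vec.∷ κ) 1F 0F) ∧ proper (P (suc n)) κ
      ≡⟨ cong (_∧ proper (P (suc n)) κ) (differ-both-ways c (κ Fin.zero)) ⟩
    not ⌊ c Fin.≟ κ Fin.zero ⌋ ∧ proper (P (suc n)) κ ∎
    where open ≡-Reasoning

  cycle-adj : ∀ n i j → adj (C (suc (suc n))) i j ≡
              adj (P (suc (suc n))) i j ∨ (edge 0F (Fin.fromℕ (suc n)) i j ∨ edge (Fin.fromℕ (suc n)) 0F i j)
  cycle-adj n i j =
    trans (sym (Bool.∨-assoc (suc (toℕ i) == toℕ j) (suc (toℕ j) == toℕ i) _))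
          (cong (adj (P (suc (suc n))) i j ∨_)
                (cong₂ _∨_ (closing i j) (trans (closing j i) (Bool.∧-comm (toℕ j == 0) (toℕ i == toℕ (Fin.fromℕ (suc n)))))))
    where
    closing : ∀ a b → (toℕ a == 0) ∧ ((toℕ b == suc n) ∧ true) ≡ edge 0F (Fin.fromℕ (suc n)) a b
    closing a b = cong ((toℕ a == 0) ∧_)
      (trans (Bool.∧-identityʳ _) (cong (toℕ b ==_) (sym (Fin.toℕ-fromℕ (suc n)))))

  proper-C : ∀ {N} n (κ : Fin (suc (suc n)) → Fin N) →
             proper (C (suc (suc n))) κ ≡ proper (P (suc (suc n))) κ ∧ not ⌊ κ Fin.zero Fin.≟ κ (Fin.fromℕ (suc n)) ⌋
  proper-C n κ = begin
    proper (C (suc (suc n))) κ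
      ≡⟨ proper-cong (cycle-adj n) κ ⟩
    proper (graph (λ i j → adj (P (suc (suc n))) i j ∨ (edge 0F last i j ∨ edge last 0F i j))) κ
      ≡⟨ proper-∪ (adj (P (suc (suc n)))) (λ i j → edge 0F last i j ∨ edge last 0F i j) κ ⟩
    proper (P (suc (suc n))) κ ∧ proper (graph (λ i j → edge 0F last i j ∨ edge last 0F i j)) κ
      ≡⟨ cong (proper (P (suc (suc n))) κ ∧_) (proper-∪ (edge 0F last) (edge last 0F) κ) ⟩
    proper (P (suc (suc n))) κ ∧ (proper (graph (edge 0F last)) κ ∧ proper (graph (edge last 0F)) κ)
      ≡⟨ cong (proper (P (suc (suc n))) κ ∧_) (cong₂ _∧_ (proper-edge 0F last κ) (proper-edge last 0F κ)) ⟩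
    proper (P (suc (suc n))) κ ∧ (differ κ 0F last ∧ differ κ last 0F)
      ≡⟨ cong (proper (P (suc (suc n))) κ ∧_) (differ-both-ways (κ 0F) (κ last)) ⟩
    proper (P (suc (suc n))) κ ∧ not ⌊ κ Fin.zero Fin.≟ κ last ⌋ ∎
    where
    open ≡-Reasoning
    last = Fin.fromℕ (suc n)

module Walks {N : ℕ} (x : Fin N → ℤ) where

  import Data.Integer.Properties as ℤ
  open import Data.Nat using (zero; suc)
  open import Data.Integer using (+_; _+_; _*_; -_; _-_)
  open import Data.Fin as Fin using ()
  open import Data.Bool using (Bool; true; false; _∧_; not; if_then_else_)
  import Data.Bool.Properties as Bool
  open import Data.List using (map; allFin)
  import Data.List.Properties as List
  import Data.Vec.Functional as Vec
  open import Function using (_∘_; id)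
  open import Relation.Nullary.Decidable using (⌊_⌋)
  open import Relation.Binary.PropositionalEquality
  open import Data.Integer.Tactic.RingSolver using (solve-∀)
  open import Defs
  open Sums
  open PowerSeries
  open Newton
  open Colourings

  -- X G x unfolds to sumColourings (V G) (λ κ → weight κ when proper G κ).
  weight : ∀ {n} → (Fin n → Fin N) → ℤ
  weight κ = prodℤ (map (x ∘ κ) (allFin _))

  weight-∷ : ∀ {n} c (κ : Fin n → Fin N) → weight (c Vec.∷ κ) ≡ x c * weight κ
  weight-∷ c κ = cong (λ ws → x c * prodℤ ws)
    (trans (List.map-tabulate Fin.suc (x ∘ (c Vec.∷ κ))) (sym (List.map-tabulate id (x ∘ κ))))

  sumColourings : ∀ n → ((Fin n → Fin N) → ℤ) → ℤ
  sumColourings n g = sumMap g (allFuns n N)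

  sumColourings-∷ : ∀ n g → sumColourings (suc n) g ≡ sumFin N (λ c → sumColourings n (g ∘ (c Vec.∷_)))
  sumColourings-∷ n g = trans (sumMap-concatMap g (λ c → map (c Vec.∷_) (allFuns n N)) (allFin N))
                              (sumMap-cong (λ c → sumMap-map g (c Vec.∷_) (allFuns n N)) (allFin N))

  walksFrom : (Fin N → ℤ) → ℕ → Fin N → ℤ
  walksFrom ψ n c = sumColourings n λ κ →
    (weight (c Vec.∷ κ) * ψ ((c Vec.∷ κ) (Fin.fromℕ n))) when proper (P (suc n)) (c Vec.∷ κ)

  walks : (Fin N → ℤ) → Series
  walks ψ zero    = + 0
  walks ψ (suc n) = sumFin N (walksFrom ψ n)

  -- Any colour other than c may come second: all walks of length n, minus those starting at c.
  walksFrom-suc : ∀ ψ n c → walksFrom ψ (suc n) c ≡ x c * (walks ψ (suc n) - walksFrom ψ n c)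
  walksFrom-suc ψ n c = begin
    walksFrom ψ (suc n) c
      ≡⟨ sumMap-cong (λ κ → trans (cong₂ _when_ (weigh κ) (proper-P-∷ n c κ))
                                 (trans (*-when (x c) (ω κ) _) (cong (x c *_) (when-not-∧ (ω κ) (start κ) (ok κ)))))
                     (allFuns (suc n) N) ⟩
    sumColourings (suc n) (λ κ → x c * (ω κ when ok κ - ω κ when (start κ ∧ ok κ)))
      ≡⟨ trans (sumMap-*ˡ (x c) _ (allFuns (suc n) N)) (cong (x c *_) (sumMap-sub _ _ (allFuns (suc n) N))) ⟩
    x c * (sumColourings (suc n) (λ κ → ω κ when ok κ) - sumColourings (suc n) (λ κ → ω κ when (start κ ∧ ok κ)))
      ≡⟨ cong (λ t → x c * (t - sumColourings (suc n) (λ κ → ω κ when (start κ ∧ ok κ)))) (sumColourings-∷ n (λ κ → ω κ when ok κ)) ⟩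
    x c * (walks ψ (suc n) - sumColourings (suc n) (λ κ → ω κ when (start κ ∧ ok κ)))
      ≡⟨ cong (λ t → x c * (walks ψ (suc n) - t)) returning ⟩
    x c * (walks ψ (suc n) - walksFrom ψ n c) ∎
    where
    open ≡-Reasoning
    ω : (Fin (suc n) → Fin N) → ℤ
    ω κ = weight κ * ψ (κ (Fin.fromℕ n))
    ok : (Fin (suc n) → Fin N) → Bool
    ok = proper (P (suc n))
    start : (Fin (suc n) → Fin N) → Bool
    start κ = ⌊ c Fin.≟ κ Fin.zero ⌋
    weigh : ∀ κ → weight (c Vec.∷ κ) * ψ (κ (Fin.fromℕ n)) ≡ x c * ω κ
    weigh κ = trans (cong (_* ψ (κ (Fin.fromℕ n))) (weight-∷ c κ)) (ℤ.*-assoc (x c) _ _)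
    returning : sumColourings (suc n) (λ κ → ω κ when (start κ ∧ ok κ)) ≡ walksFrom ψ n c
    returning = begin
      sumColourings (suc n) (λ κ → ω κ when (start κ ∧ ok κ))
        ≡⟨ sumColourings-∷ n _ ⟩
      sumFin N (λ d → sumColourings n (λ κ → ω (d Vec.∷ κ) when (⌊ c Fin.≟ d ⌋ ∧ ok (d Vec.∷ κ))))
        ≡⟨ sumMap-cong (λ d → trans (sumMap-cong (λ κ → when-∧ (ω (d Vec.∷ κ)) ⌊ c Fin.≟ d ⌋ (ok (d Vec.∷ κ))) (allFuns n N))
                                    (sumMap-when _ ⌊ c Fin.≟ d ⌋ (allFuns n N))) (allFin N) ⟩
      sumFin N (λ d → walksFrom ψ n d when ⌊ c Fin.≟ d ⌋)
        ≡⟨ sumFin-select c (walksFrom ψ n) ⟩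
      walksFrom ψ n c ∎

  walksFrom-closed : ∀ ψ n c → walksFrom ψ n c ≡ (u (x c) ⊛ walks ψ) (suc n) + ψ c * u (x c) (suc n)
  walksFrom-closed ψ zero    c = single (x c) (walks ψ 1) (ψ c)
    where
    single : ∀ y s b → y * + 1 * b + + 0 ≡ + 0 * s + y * + 0 + b * y
    single = solve-∀
  walksFrom-closed ψ (suc m) c = begin
    walksFrom ψ (suc m) c
      ≡⟨ walksFrom-suc ψ m c ⟩
    y * (S (suc m) - walksFrom ψ m c)
      ≡⟨ cong (λ t → y * (S (suc m) - t)) (walksFrom-closed ψ m c) ⟩
    y * (S (suc m) - ((u y ⊛ S) (suc m) + ψ c * u y (suc m)))
      ≡⟨ regroup y (S (suc m)) ((u y ⊛ S) (suc m)) (ψ c) (u y (suc m)) (S (suc (suc m))) ⟩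
    + 0 * S (suc (suc m)) + y * (S (suc m) - (u y ⊛ S) (suc m)) + ψ c * - (y * u y (suc m))
      ≡⟨ cong (λ t → + 0 * S (suc (suc m)) + t + ψ c * - (y * u y (suc m))) (sym shifted) ⟩
    (u y ⊛ S) (suc (suc m)) + ψ c * u y (suc (suc m)) ∎
    where
    open ≡-Reasoning
    y = x c
    S = walks ψ
    regroup : ∀ y s a b v s′ → y * (s - (a + b * v)) ≡ + 0 * s′ + y * (s - a) + b * - (y * v)
    regroup = solve-∀
    shifted : (shift (u y) ⊛ S) (suc m) ≡ y * (S (suc m) - (u y ⊛ S) (suc m))
    shifted = begin
      (shift (u y) ⊛ S) (suc m)                ≡⟨ ⊛-congˡ (shift-u y) (suc m) ⟩
      ((y · (𝟙 ⊖ u y)) ⊛ S) (suc m)            ≡⟨ ·-⊛ y (𝟙 ⊖ u y) S (suc m) ⟩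
      y * ((𝟙 ⊖ u y) ⊛ S) (suc m)              ≡⟨ cong (y *_) (⊛-distribʳ-⊖ 𝟙 (u y) S (suc m)) ⟩
      y * ((𝟙 ⊛ S) (suc m) - (u y ⊛ S) (suc m)) ≡⟨ cong (λ t → y * (t - (u y ⊛ S) (suc m))) (⊛-identityˡ S (suc m)) ⟩
      y * (S (suc m) - (u y ⊛ S) (suc m))      ∎

  walks-equation : ∀ ψ → walks ψ ≗ π x ⊛ walks ψ ⊕ sumˢ N (λ c → ψ c · u (x c))
  walks-equation ψ zero    = sym (cong₂ _+_ (ℤ.*-zeroʳ (π x 0))
    (trans (sumMap-cong (λ c → ℤ.*-zeroʳ (ψ c)) (allFin N)) (sumMap-zero (allFin N))))
  walks-equation ψ (suc m) = begin
    sumFin N (walksFrom ψ m)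
      ≡⟨ sumMap-cong (walksFrom-closed ψ m) (allFin N) ⟩
    sumFin N (λ c → (u (x c) ⊛ walks ψ) (suc m) + ψ c * u (x c) (suc m))
      ≡⟨ sumMap-+ _ _ (allFin N) ⟩
    sumˢ N (λ c → u (x c) ⊛ walks ψ) (suc m) + sumˢ N (λ c → ψ c · u (x c)) (suc m)
      ≡⟨ cong (_+ sumˢ N (λ c → ψ c · u (x c)) (suc m)) (sym (⊛-sumˢ N (u ∘ x) (walks ψ) (suc m))) ⟩
    (π x ⊛ walks ψ) (suc m) + sumˢ N (λ c → ψ c · u (x c)) (suc m) ∎
    where open ≡-Reasoning

  chromaticPaths : Series
  chromaticPaths n = X (P n) x

  paths≡𝟙+walks : ∀ n → chromaticPaths n ≡ 𝟙 n + walks (λ _ → + 1) n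
  paths≡𝟙+walks zero    = refl
  paths≡𝟙+walks (suc n) = sym (trans (ℤ.+-identityˡ _) (trans
    (sumMap-cong (λ c → sumMap-cong (λ κ → cong (_when proper (P (suc n)) (c Vec.∷ κ)) (ℤ.*-identityʳ _))
                                    (allFuns n N))
                 (allFin N))
    (sym (sumColourings-∷ n _))))

  paths-equation : chromaticPaths ≗ 𝟙 ⊕ π x ⊛ chromaticPaths
  paths-equation n = begin
    chromaticPaths n
      ≡⟨ paths≡𝟙+walks n ⟩
    𝟙 n + S n
      ≡⟨ cong (_+_ (𝟙 n)) (walks-equation (λ _ → + 1) n) ⟩
    𝟙 n + ((π x ⊛ S) n + sumˢ N (λ c → + 1 · u (x c)) n)
      ≡⟨ cong (λ t → 𝟙 n + ((π x ⊛ S) n + t)) (trans (sumMap-cong (λ c → ℤ.*-identityˡ (u (x c) n)) (allFin N))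
                                                     (sym (⊛-identityʳ (π x) n))) ⟩
    𝟙 n + ((π x ⊛ S) n + (π x ⊛ 𝟙) n)
      ≡⟨ cong (_+_ (𝟙 n)) (sym (⊛-distribˡ (π x) S 𝟙 n)) ⟩
    𝟙 n + (π x ⊛ (S ⊕ 𝟙)) n
      ≡⟨ cong (_+_ (𝟙 n)) (⊛-congʳ (λ k → trans (ℤ.+-comm (S k) (𝟙 k)) (sym (paths≡𝟙+walks k))) n) ⟩
    𝟙 n + (π x ⊛ chromaticPaths) n ∎
    where
    open ≡-Reasoning
    S = walks (λ _ → + 1)

  endsAt : Fin N → Fin N → ℤ
  endsAt t c = + 1 when ⌊ t Fin.≟ c ⌋

  walks-endsAt : ∀ t → walks (endsAt t) ≗ chromaticPaths ⊛ u (x t)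
  walks-endsAt t = geometric-unique (π x) chromaticPaths paths-equation (walks (endsAt t)) (u (x t)) λ n → begin
    walks (endsAt t) n
      ≡⟨ walks-equation (endsAt t) n ⟩
    (π x ⊛ walks (endsAt t)) n + sumFin N (λ c → endsAt t c * u (x c) n)
      ≡⟨ cong (_+_ ((π x ⊛ walks (endsAt t)) n))
              (trans (sumMap-cong (λ c → indicator ⌊ t Fin.≟ c ⌋ (u (x c) n)) (allFin N)) (sumFin-select t (λ c → u (x c) n))) ⟩
    (π x ⊛ walks (endsAt t)) n + u (x t) n
      ≡⟨ ℤ.+-comm ((π x ⊛ walks (endsAt t)) n) (u (x t) n) ⟩
    u (x t) n + (π x ⊛ walks (endsAt t)) n ∎
    where
    open ≡-Reasoning
    indicator : ∀ b v → (+ 1 when b) * v ≡ v when b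
    indicator true  v = ℤ.*-identityˡ v
    indicator false v = ℤ.*-zeroˡ v

  closedWalks : Series
  closedWalks zero    = + 0
  closedWalks (suc m) = sumFin N (λ d → walksFrom (endsAt d) m d)

  closedWalks-formula : ∀ m → closedWalks (suc m) ≡ (chromaticPaths ⊛ (π x ⊖ D (π x))) (suc m) + π x (suc m)
  closedWalks-formula m = begin
    sumFin N (λ d → walksFrom (endsAt d) m d)
      ≡⟨ sumMap-cong (λ d → trans (walksFrom-closed (endsAt d) m d)
                                  (cong₂ _+_ (⊛-congʳ {u (x d)} (walks-endsAt d) (suc m))
                                             (trans (cong (λ b → (+ 1 when b) * u (x d) (suc m)) (≟-refl d)) (ℤ.*-identityˡ _))))
                     (allFin N) ⟩
    sumFin N (λ d → (u (x d) ⊛ (chromaticPaths ⊛ u (x d))) (suc m) + u (x d) (suc m))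
      ≡⟨ sumMap-+ _ _ (allFin N) ⟩
    sumˢ N (λ d → u (x d) ⊛ (chromaticPaths ⊛ u (x d))) (suc m) + π x (suc m)
      ≡⟨ cong (_+ π x (suc m)) (trans (sumˢ-cong N (λ d → reassociate (u (x d))) (suc m))
                                      (sym (⊛-sumˢ N (λ d → u (x d) ⊛ u (x d)) chromaticPaths (suc m)))) ⟩
    (sumˢ N (λ d → u (x d) ⊛ u (x d)) ⊛ chromaticPaths) (suc m) + π x (suc m)
      ≡⟨ cong (_+ π x (suc m)) (trans (⊛-congˡ squares (suc m)) (⊛-comm (π x ⊖ D (π x)) chromaticPaths (suc m))) ⟩
    (chromaticPaths ⊛ (π x ⊖ D (π x))) (suc m) + π x (suc m) ∎
    where
    open ≡-Reasoning
    reassociate : ∀ f → f ⊛ (chromaticPaths ⊛ f) ≗ (f ⊛ f) ⊛ chromaticPaths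
    reassociate f k = trans (⊛-congʳ {f} (⊛-comm chromaticPaths f) k) (sym (⊛-assoc f f chromaticPaths k))
    squares : sumˢ N (λ d → u (x d) ⊛ u (x d)) ≗ π x ⊖ D (π x)
    squares k = trans (sumˢ-cong N (λ d → u-square (x d)) k)
                      (trans (sumˢ-⊖ N (u ∘ x) (D ∘ u ∘ x) k) (cong (_-_ (π x k)) (sumˢ-D N (u ∘ x) k)))

  cycle≡paths-closedWalks : ∀ n → X (C (suc (suc n))) x ≡ chromaticPaths (suc (suc n)) - closedWalks (suc (suc n))
  cycle≡paths-closedWalks n = begin
    sumColourings r (λ κ → weight κ when proper (C r) κ)
      ≡⟨ sumMap-cong (λ κ → trans (cong (weight κ when_) (trans (proper-C n κ) (Bool.∧-comm (proper (P r) κ) _)))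
                                 (when-not-∧ (weight κ) (closes κ) (proper (P r) κ))) (allFuns r N) ⟩
    sumColourings r (λ κ → weight κ when proper (P r) κ - weight κ when (closes κ ∧ proper (P r) κ))
      ≡⟨ sumMap-sub _ _ (allFuns r N) ⟩
    chromaticPaths r - sumColourings r (λ κ → weight κ when (closes κ ∧ proper (P r) κ))
      ≡⟨ cong (_-_ (chromaticPaths r)) (trans (sumColourings-∷ (suc n) _)
                                              (sumMap-cong (λ d → sumMap-cong (closing d) (allFuns (suc n) N)) (allFin N))) ⟩
    chromaticPaths r - closedWalks r ∎
    where
    open ≡-Reasoning
    r = suc (suc n)
    closes : (Fin r → Fin N) → Bool
    closes κ = ⌊ κ Fin.zero Fin.≟ κ (Fin.fromℕ (suc n)) ⌋
    closing : ∀ d κ → weight (d Vec.∷ κ) when (closes (d Vec.∷ κ) ∧ proper (P r) (d Vec.∷ κ))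
                    ≡ (weight (d Vec.∷ κ) * endsAt d (κ (Fin.fromℕ n))) when proper (P r) (d Vec.∷ κ)
    closing d κ = weigh (weight (d Vec.∷ κ)) (closes (d Vec.∷ κ)) (proper (P r) (d Vec.∷ κ))
      where
      weigh : ∀ w a b → w when (a ∧ b) ≡ (w * (+ 1 when a)) when b
      weigh w true  b = cong (_when b) (sym (ℤ.*-identityʳ w))
      weigh w false true  = sym (ℤ.*-zeroʳ w)
      weigh w false false = refl

module Compositions where

  open import Data.Nat as ℕ using (ℕ; zero; suc; _∸_; _≤_; _<_; z≤n; _≤?_; _+_; _⊓_; _⊔_)
  import Data.Nat.Properties as ℕ
  open import Data.Nat.ListAction using (sum)
  open import Data.Nat.ListAction.Properties using (sum-↭)
  open import Data.Integer as ℤ using (ℤ)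
  import Data.Integer.Properties as ℤ
  import Data.List
  open import Data.List using (List; []; _∷_; [_]; _∷ʳ_; _++_; foldr; filter; scanl; reverse)
  import Data.List.Properties as List
  open import Data.List.Relation.Binary.Permutation.Propositional.Properties using (↭-reverse)
  open import Function using (_∘_)
  open import Relation.Nullary using (yes; no)
  open import Relation.Binary.PropositionalEquality hiding ([_])
  open import Defs
  open Sums

  sumComp-cong : ∀ n {f g : List ℕ → ℤ} → f ≗ g → sumComp n f ≡ sumComp n g
  sumComp-cong n f≗g = sumMap-cong f≗g (compositions n)

  sumComp-suc : ∀ n f → sumComp (suc n) f ≡ sumComp n (λ J → f (1 ∷ J) ℤ.+ sumMap f (incFirst J))
  sumComp-suc n f = sumMap-concatMap f (λ J → (1 ∷ J) ∷ incFirst J) (compositions n)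

  sumComp-cong-sum : ∀ n {f g : List ℕ → ℤ} → (∀ I → sum I ≡ n → f I ≡ g I) → sumComp n f ≡ sumComp n g
  sumComp-cong-sum zero    f≡g = cong (ℤ._+ ℤ.+ 0) (f≡g [] refl)
  sumComp-cong-sum (suc n) {f} {g} f≡g = begin
    sumComp (suc n) f
      ≡⟨ sumComp-suc n f ⟩
    sumComp n (λ J → f (1 ∷ J) ℤ.+ sumMap f (incFirst J))
      ≡⟨ sumComp-cong-sum n (λ J ΣJ≡n → cong₂ ℤ._+_ (f≡g (1 ∷ J) (cong suc ΣJ≡n)) (incremented J ΣJ≡n)) ⟩
    sumComp n (λ J → g (1 ∷ J) ℤ.+ sumMap g (incFirst J))
      ≡⟨ sym (sumComp-suc n g) ⟩
    sumComp (suc n) g ∎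
    where
    open ≡-Reasoning
    incremented : ∀ J → sum J ≡ n → sumMap f (incFirst J) ≡ sumMap g (incFirst J)
    incremented []      _    = refl
    incremented (a ∷ J) ΣJ≡n = cong (ℤ._+ ℤ.+ 0) (f≡g (suc a ∷ J) (cong suc ΣJ≡n))

  sumComp-firstPart : ∀ n f → sumComp (suc n) f ≡ ∑< (suc n) (λ a → sumComp (n ∸ a) (λ J → f (suc a ∷ J)))
  sumComp-firstPart zero    f = sym (ℤ.+-identityʳ (f [ 1 ] ℤ.+ ℤ.+ 0))
  sumComp-firstPart (suc n) f = begin
    sumComp (suc (suc n)) f
      ≡⟨ sumComp-suc (suc n) f ⟩
    sumComp (suc n) (λ J → f (1 ∷ J) ℤ.+ sumMap f (incFirst J))
      ≡⟨ sumMap-+ (λ J → f (1 ∷ J)) (λ J → sumMap f (incFirst J)) (compositions (suc n)) ⟩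
    sumComp (suc n) (λ J → f (1 ∷ J)) ℤ.+ sumComp (suc n) (λ J → sumMap f (incFirst J))
      ≡⟨ cong (ℤ._+_ (sumComp (suc n) (λ J → f (1 ∷ J)))) (sumComp-firstPart n (λ J → sumMap f (incFirst J))) ⟩
    sumComp (suc n) (λ J → f (1 ∷ J)) ℤ.+ ∑< (suc n) (λ a → sumComp (n ∸ a) (λ J → f (suc (suc a) ∷ J) ℤ.+ ℤ.+ 0))
      ≡⟨ cong (ℤ._+_ (sumComp (suc n) (λ J → f (1 ∷ J))))
              (∑<-cong (suc n) (λ a → sumComp-cong (n ∸ a) (λ J → ℤ.+-identityʳ (f (suc (suc a) ∷ J))))) ⟩
    ∑< (suc (suc n)) (λ a → sumComp (suc n ∸ a) (λ J → f (suc a ∷ J))) ∎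
    where open ≡-Reasoning

  -- If c ≤ b then c ∸ b = 0 and the recursive call contributes nothing.
  σ⁺′ : List ℕ → ℕ → ℕ
  σ⁺′ _       zero    = 0
  σ⁺′ []      (suc _) = 0
  σ⁺′ (b ∷ J) (suc d) = b + σ⁺′ J (suc d ∸ b)

  σ⁺′-[] : ∀ c → σ⁺′ [] c ≡ 0
  σ⁺′-[] zero    = refl
  σ⁺′-[] (suc c) = refl

  σ⁺′-∷ : ∀ b J {t} → 0 < t → σ⁺′ (b ∷ J) t ≡ b + σ⁺′ J (t ∸ b)
  σ⁺′-∷ b J {suc t} _ = refl

  σ⁺′-≤ : ∀ I c → σ⁺′ I c ≤ sum I
  σ⁺′-≤ _       zero    = z≤n
  σ⁺′-≤ []      (suc c) = z≤n
  σ⁺′-≤ (b ∷ J) (suc c) = ℕ.+-monoʳ-≤ b (σ⁺′-≤ J (suc c ∸ b))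

  σ⁺′-sum : ∀ I → σ⁺′ I (sum I) ≡ sum I
  σ⁺′-sum []      = refl
  σ⁺′-sum (b ∷ J) with b + sum J in eq
  ... | zero  = refl
  ... | suc d = begin
    b + σ⁺′ J (suc d ∸ b)      ≡⟨ cong (λ t → b + σ⁺′ J (t ∸ b)) (sym eq) ⟩
    b + σ⁺′ J (b + sum J ∸ b)  ≡⟨ cong (λ t → b + σ⁺′ J t) (ℕ.m+n∸m≡n b (sum J)) ⟩
    b + σ⁺′ J (sum J)          ≡⟨ cong (b +_) (σ⁺′-sum J) ⟩
    b + sum J                  ≡⟨ eq ⟩
    suc d                      ∎
    where open ≡-Reasoning

  σ⁺-from : ∀ I z c → foldr _⊓_ (z + sum I) (filter (c ≤?_) (scanl _+_ z I)) ≡ z + σ⁺′ I (c ∸ z)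
  σ⁺-from [] z c with c ≤? z
  ... | yes c≤z = begin
    foldr _⊓_ (z + 0) (filter (c ≤?_) [ z ])  ≡⟨ cong (foldr _⊓_ (z + 0)) (List.filter-accept (c ≤?_) c≤z) ⟩
    z ⊓ (z + 0)          ≡⟨ ℕ.m≤n⇒m⊓n≡m (ℕ.m≤m+n z 0) ⟩
    z                    ≡⟨ sym (ℕ.+-identityʳ z) ⟩
    z + 0                ≡⟨ cong (z +_) (sym (σ⁺′-[] (c ∸ z))) ⟩
    z + σ⁺′ [] (c ∸ z)   ∎
    where open ≡-Reasoning
  ... | no  c≰z = trans (cong (foldr _⊓_ (z + 0)) (List.filter-reject (c ≤?_) c≰z)) (cong (z +_) (sym (σ⁺′-[] (c ∸ z))))
  σ⁺-from (b ∷ J) z c with c ≤? z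
  ... | yes c≤z = begin
    foldr _⊓_ (z + (b + sum J)) (filter (c ≤?_) (z ∷ scanl _+_ (z + b) J))
                                 ≡⟨ cong (foldr _⊓_ (z + (b + sum J))) (List.filter-accept (c ≤?_) c≤z) ⟩
    z ⊓ rest                     ≡⟨ ℕ.m≤n⇒m⊓n≡m (ℕ.≤-trans (ℕ.m≤m+n z b) (subst (z + b ≤_) (sym rest≡) (ℕ.m≤m+n (z + b) _))) ⟩
    z                            ≡⟨ sym (ℕ.+-identityʳ z) ⟩
    z + σ⁺′ (b ∷ J) 0            ≡⟨ cong (λ t → z + σ⁺′ (b ∷ J) t) (sym (ℕ.m≤n⇒m∸n≡0 c≤z)) ⟩
    z + σ⁺′ (b ∷ J) (c ∸ z)      ∎
    where
    open ≡-Reasoning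
    rest = foldr _⊓_ (z + (b + sum J)) (filter (c ≤?_) (scanl _+_ (z + b) J))
    rest≡ : rest ≡ z + b + σ⁺′ J (c ∸ (z + b))
    rest≡ = trans (cong (λ t → foldr _⊓_ t (filter (c ≤?_) (scanl _+_ (z + b) J))) (sym (ℕ.+-assoc z b (sum J))))
                  (σ⁺-from J (z + b) c)
  ... | no  c≰z = begin
    foldr _⊓_ (z + (b + sum J)) (filter (c ≤?_) (z ∷ scanl _+_ (z + b) J))
      ≡⟨ cong (foldr _⊓_ (z + (b + sum J))) (List.filter-reject (c ≤?_) c≰z) ⟩
    foldr _⊓_ (z + (b + sum J)) (filter (c ≤?_) (scanl _+_ (z + b) J))
      ≡⟨ cong (λ t → foldr _⊓_ t (filter (c ≤?_) (scanl _+_ (z + b) J))) (sym (ℕ.+-assoc z b (sum J))) ⟩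
    foldr _⊓_ (z + b + sum J) (filter (c ≤?_) (scanl _+_ (z + b) J))
      ≡⟨ σ⁺-from J (z + b) c ⟩
    z + b + σ⁺′ J (c ∸ (z + b))
      ≡⟨ ℕ.+-assoc z b _ ⟩
    z + (b + σ⁺′ J (c ∸ (z + b)))
      ≡⟨ cong (λ t → z + (b + σ⁺′ J t)) (sym (ℕ.∸-+-assoc c z b)) ⟩
    z + (b + σ⁺′ J (c ∸ z ∸ b))
      ≡⟨ cong (z +_) (sym (σ⁺′-∷ b J (ℕ.m<n⇒0<n∸m (ℕ.≰⇒> c≰z)))) ⟩
    z + σ⁺′ (b ∷ J) (c ∸ z) ∎
    where open ≡-Reasoning

  σ⁺≡σ⁺′ : ∀ I c → σ⁺ I c ≡ σ⁺′ I c
  σ⁺≡σ⁺′ I c = σ⁺-from I 0 c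

  scanl-∷ʳ : ∀ xs z b → scanl _+_ z (xs ∷ʳ b) ≡ scanl _+_ z xs ∷ʳ (z + sum xs + b)
  scanl-∷ʳ []       z b = cong (λ t → z ∷ [ t + b ]) (sym (ℕ.+-identityʳ z))
  scanl-∷ʳ (x ∷ xs) z b = cong (z ∷_) (trans (scanl-∷ʳ xs (z + x) b)
    (cong (λ t → scanl _+_ (z + x) xs ∷ʳ (t + b)) (ℕ.+-assoc z x (sum xs))))

  foldr-⊔ : ∀ ys k → foldr _⊔_ k ys ≡ foldr _⊔_ 0 ys ⊔ k
  foldr-⊔ []       k = refl
  foldr-⊔ (y ∷ ys) k = trans (cong (y ⊔_) (foldr-⊔ ys k)) (sym (ℕ.⊔-assoc y _ k))

  σ⁻-∷ʳ : ∀ xs b m → σ⁻ (xs ∷ʳ b) m ≡ σ⁻ xs m ⊔ foldr _⊔_ 0 (filter (_≤? m) [ sum xs + b ])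
  σ⁻-∷ʳ xs b m = begin
    foldr _⊔_ 0 (filter (_≤? m) (scanl _+_ 0 (xs ∷ʳ b)))
      ≡⟨ cong (foldr _⊔_ 0 ∘ filter (_≤? m)) (scanl-∷ʳ xs 0 b) ⟩
    foldr _⊔_ 0 (filter (_≤? m) (scanl _+_ 0 xs ∷ʳ (sum xs + b)))
      ≡⟨ cong (foldr _⊔_ 0) (List.filter-++ (_≤? m) (scanl _+_ 0 xs) [ sum xs + b ]) ⟩
    foldr _⊔_ 0 (filter (_≤? m) (scanl _+_ 0 xs) ++ filter (_≤? m) [ sum xs + b ])
      ≡⟨ List.foldr-++ _⊔_ 0 (filter (_≤? m) (scanl _+_ 0 xs)) _ ⟩
    foldr _⊔_ (foldr _⊔_ 0 (filter (_≤? m) [ sum xs + b ])) (filter (_≤? m) (scanl _+_ 0 xs))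
      ≡⟨ foldr-⊔ (filter (_≤? m) (scanl _+_ 0 xs)) _ ⟩
    σ⁻ xs m ⊔ foldr _⊔_ 0 (filter (_≤? m) [ sum xs + b ]) ∎
    where open ≡-Reasoning

  -- The partial sums of the reversed composition are the complements sum I - s of those of I.
  σ⁻-reverse : ∀ I m → σ⁻ (reverse I) m ≡ sum I ∸ σ⁺′ I (sum I ∸ m)
  σ⁻-reverse []      m = sym (cong (0 ∸_) (σ⁺′-[] (0 ∸ m)))
  σ⁻-reverse (b ∷ J) m = trans unfold (last (b + sum J ≤? m))
    where
    open ≡-Reasoning
    unfold : σ⁻ (reverse (b ∷ J)) m ≡ σ⁻ (reverse J) m ⊔ foldr _⊔_ 0 (filter (_≤? m) [ b + sum J ])
    unfold = begin
      σ⁻ (reverse (b ∷ J)) m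
        ≡⟨ cong (λ xs → σ⁻ xs m) (List.unfold-reverse b J) ⟩
      σ⁻ (reverse J ∷ʳ b) m
        ≡⟨ σ⁻-∷ʳ (reverse J) b m ⟩
      σ⁻ (reverse J) m ⊔ foldr _⊔_ 0 (filter (_≤? m) [ sum (reverse J) + b ])
        ≡⟨ cong (λ s → σ⁻ (reverse J) m ⊔ foldr _⊔_ 0 (filter (_≤? m) [ s ]))
                (trans (cong (_+ b) (sum-↭ (↭-reverse J))) (ℕ.+-comm (sum J) b)) ⟩
      σ⁻ (reverse J) m ⊔ foldr _⊔_ 0 (filter (_≤? m) [ b + sum J ]) ∎
    last : ∀ d → σ⁻ (reverse J) m ⊔ foldr _⊔_ 0 (filter (_≤? m) [ b + sum J ]) ≡ b + sum J ∸ σ⁺′ (b ∷ J) (b + sum J ∸ m)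
    last (yes ≤m) = begin
      σ⁻ (reverse J) m ⊔ foldr _⊔_ 0 (filter (_≤? m) [ b + sum J ])
                                           ≡⟨ cong (λ ys → σ⁻ (reverse J) m ⊔ foldr _⊔_ 0 ys) (List.filter-accept (_≤? m) ≤m) ⟩
      σ⁻ (reverse J) m ⊔ (b + sum J ⊔ 0)   ≡⟨ cong (σ⁻ (reverse J) m ⊔_) (ℕ.⊔-identityʳ _) ⟩
      σ⁻ (reverse J) m ⊔ (b + sum J)       ≡⟨ ℕ.m≤n⇒m⊔n≡n (ℕ.≤-trans σ⁻≤ (ℕ.m≤n+m (sum J) b)) ⟩
      b + sum J                            ≡⟨ cong (λ t → b + sum J ∸ σ⁺′ (b ∷ J) t) (sym (ℕ.m≤n⇒m∸n≡0 ≤m)) ⟩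
      b + sum J ∸ σ⁺′ (b ∷ J) (b + sum J ∸ m) ∎
      where
      σ⁻≤ : σ⁻ (reverse J) m ≤ sum J
      σ⁻≤ = subst (_≤ sum J) (sym (σ⁻-reverse J m)) (ℕ.m∸n≤m (sum J) (σ⁺′ J (sum J ∸ m)))
    last (no ≰m) = begin
      σ⁻ (reverse J) m ⊔ foldr _⊔_ 0 (filter (_≤? m) [ b + sum J ])
                                                    ≡⟨ cong (λ ys → σ⁻ (reverse J) m ⊔ foldr _⊔_ 0 ys) (List.filter-reject (_≤? m) ≰m) ⟩
      σ⁻ (reverse J) m ⊔ 0                          ≡⟨ ℕ.⊔-identityʳ _ ⟩
      σ⁻ (reverse J) m                              ≡⟨ σ⁻-reverse J m ⟩
      sum J ∸ σ⁺′ J (sum J ∸ m)                     ≡⟨ cong (λ t → sum J ∸ σ⁺′ J t) (sym (shifted)) ⟩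
      sum J ∸ σ⁺′ J (b + sum J ∸ m ∸ b)             ≡⟨ sym (ℕ.[m+n]∸[m+o]≡n∸o b (sum J) _) ⟩
      b + sum J ∸ (b + σ⁺′ J (b + sum J ∸ m ∸ b))   ≡⟨ cong (b + sum J ∸_) (sym (σ⁺′-∷ b J (ℕ.m<n⇒0<n∸m (ℕ.≰⇒> ≰m)))) ⟩
      b + sum J ∸ σ⁺′ (b ∷ J) (b + sum J ∸ m)       ∎
      where
      shifted : b + sum J ∸ m ∸ b ≡ sum J ∸ m
      shifted = trans (ℕ.∸-+-assoc (b + sum J) m b)
                      (trans (cong (b + sum J ∸_) (ℕ.+-comm m b)) (ℕ.[m+n]∸[m+o]≡n∸o b (sum J) m))

  sumComp-cong-firstPart : ∀ n {f g : List ℕ → ℤ} → (∀ a J → f (suc a ∷ J) ≡ g (suc a ∷ J)) →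
                           sumComp (suc n) f ≡ sumComp (suc n) g
  sumComp-cong-firstPart n {f} {g} f≡g = begin
    sumComp (suc n) f                                              ≡⟨ sumComp-firstPart n f ⟩
    ∑< (suc n) (λ a → sumComp (n ∸ a) (λ J → f (suc a ∷ J)))      ≡⟨ ∑<-cong (suc n) (λ a → sumComp-cong (n ∸ a) (f≡g a)) ⟩
    ∑< (suc n) (λ a → sumComp (n ∸ a) (λ J → g (suc a ∷ J)))      ≡⟨ sym (sumComp-firstPart n g) ⟩
    sumComp (suc n) g                                              ∎
    where open ≡-Reasoning

  ∏[i-1] : List ℕ → ℕ
  ∏[i-1] J = foldr ℕ._*_ 1 (Data.List.map (_∸ 1) J)

module CompositionSeries {N : ℕ} (x : Fin N → ℤ) where

  open import Data.Nat as ℕ using (zero; suc; _∸_; _≤_; _<_; s≤s)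
  import Data.Nat.Properties as ℕ
  open import Data.Nat.Induction using (<-rec)
  open import Data.Integer using (+_; _+_; _*_)
  import Data.Integer.Properties as ℤ
  open import Data.List using (List; _∷_)
  open import Relation.Binary.PropositionalEquality
  open import Data.Integer.Tactic.RingSolver using (solve-∀)
  open import Defs
  open Sums
  open PowerSeries
  open Newton using (E)
  open Compositions

  F : Series
  F b = + (b ∸ 1) * e b x

  Q : Series
  Q m = sumComp m (λ J → + ∏[i-1] J * eI J x)

  pathSeries : Series
  pathSeries = D (E x) ⊛ Q ⊕ 𝟙

  cycleSeries : Series
  cycleSeries = D F ⊛ Q

  Q-equation : Q ≗ 𝟙 ⊕ F ⊛ Q
  Q-equation zero    = refl
  Q-equation (suc m) = begin
    Q (suc m)
      ≡⟨ sumComp-firstPart m _ ⟩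
    ∑< (suc m) (λ a → sumComp (m ∸ a) (λ J → + ∏[i-1] (suc a ∷ J) * eI (suc a ∷ J) x))
      ≡⟨ ∑<-cong (suc m) (λ a → trans (sumComp-cong (m ∸ a) (λ J → regroup a (∏[i-1] J) (e (suc a) x) (eI J x)))
                                      (sumMap-*ˡ (F (suc a)) _ (compositions (m ∸ a)))) ⟩
    ∑< (suc m) (λ a → F (suc a) * Q (m ∸ a))
      ≡⟨ sym (⊛-as-∑< (shift F) Q m) ⟩
    (shift F ⊛ Q) m
      ≡⟨ sym (trans (ℤ.+-identityˡ _) (⊛-suc F Q m refl)) ⟩
    𝟙 (suc m) + (F ⊛ Q) (suc m) ∎
    where
    open ≡-Reasoning
    regroup : ∀ a w E eJ → + (a ℕ.* w) * (E * eJ) ≡ + a * E * (+ w * eJ)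
    regroup a w E eJ = trans (cong (_* (E * eJ)) (ℤ.pos-* a w)) (shuffle (+ a) (+ w) E eJ)
      where
      shuffle : ∀ a w E eJ → a * w * (E * eJ) ≡ a * E * (w * eJ)
      shuffle = solve-∀

  U : ℕ → ℕ → ℤ
  U m d = sumComp m (λ J → + (σ⁺′ J d ℕ.* ∏[i-1] J) * eI J x)

  U-zero : ∀ m → U m 0 ≡ + 0
  U-zero m = sumMap-zero (compositions m)

  ∑<-U : ∀ (φ : Series) d m → (∀ a → a < d → U (m ∸ a) (d ∸ a) ≡ ∑< (d ∸ a) (λ s → Q s * cycleSeries (m ∸ a ∸ s))) →
         ∑< d (λ a → φ a * U (m ∸ a) (d ∸ a)) ≡ ∑< d (λ t → (φ ⊛ Q) t * cycleSeries (m ∸ t))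
  ∑<-U φ d m U≡ = begin
    ∑< d (λ a → φ a * U (m ∸ a) (d ∸ a))
      ≡⟨ ∑<-cong< d (λ a a<d → trans (cong (φ a *_) (U≡ a a<d)) (trans (sym (∑<-*ˡ (d ∸ a) (φ a) _))
           (∑<-cong (d ∸ a) (λ s → cong (λ k → φ a * (Q s * cycleSeries k)) (ℕ.∸-+-assoc m a s))))) ⟩
    ∑< d (λ a → ∑< (d ∸ a) (λ s → φ a * (Q s * cycleSeries (m ∸ (a ℕ.+ s)))))
      ≡⟨ sym (∑<-triangle d (λ a s → φ a * (Q s * cycleSeries (m ∸ (a ℕ.+ s))))) ⟩
    ∑< d (λ t → ∑< (suc t) (λ a → φ a * (Q (t ∸ a) * cycleSeries (m ∸ (a ℕ.+ (t ∸ a))))))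
      ≡⟨ ∑<-cong d (λ t → trans (∑<-cong< (suc t) (λ a a≤t →
           trans (cong (λ k → φ a * (Q (t ∸ a) * cycleSeries (m ∸ k))) (ℕ.m+[n∸m]≡n (ℕ.≤-pred a≤t)))
                 (sym (ℤ.*-assoc (φ a) (Q (t ∸ a)) _))))
         (trans (∑<-*ʳ (suc t) (λ a → φ a * Q (t ∸ a)) _) (cong (_* cycleSeries (m ∸ t)) (sym (⊛-as-∑< φ Q t))))) ⟩
    ∑< d (λ t → (φ ⊛ Q) t * cycleSeries (m ∸ t)) ∎
    where open ≡-Reasoning

  Q-suc : ∀ t → (shift F ⊛ Q) t ≡ Q (suc t)
  Q-suc t = sym (trans (Q-equation (suc t)) (trans (ℤ.+-identityˡ _) (⊛-suc F Q t refl)))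

  pathSeries-suc : ∀ t → (shift (D (E x)) ⊛ Q) t ≡ pathSeries (suc t)
  pathSeries-suc t = sym (trans (ℤ.+-identityʳ _) (⊛-suc (D (E x)) Q t refl))

  cycleSeries-1 : cycleSeries 1 ≡ + 0
  cycleSeries-1 = vanish (Q 1) (e 1 x)
    where
    vanish : ∀ q e → + 0 * q + + 1 * (+ 0 * e) * + 1 ≡ + 0
    vanish = solve-∀

  firstPart-expansion : ∀ (f : List ℕ → ℕ) (φ : Series) d m →
    (∀ a J → + f (suc a ∷ J) * eI (suc a ∷ J) x ≡
             shift (D F) a * (+ ∏[i-1] J * eI J x) + φ a * (+ (σ⁺′ J (d ∸ a) ℕ.* ∏[i-1] J) * eI J x)) →
    d ≤ m →
    (∀ a → a < d → U (m ∸ a) (d ∸ a) ≡ ∑< (d ∸ a) (λ s → Q s * cycleSeries (m ∸ a ∸ s))) →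
    sumComp (suc m) (λ I → + f I * eI I x) ≡ cycleSeries (suc m) + ∑< d (λ t → (φ ⊛ Q) t * cycleSeries (m ∸ t))
  firstPart-expansion f φ d m split d≤m U≡ = begin
    sumComp (suc m) (λ I → + f I * eI I x)
      ≡⟨ sumComp-firstPart m _ ⟩
    ∑< (suc m) (λ a → sumComp (m ∸ a) (λ J → + f (suc a ∷ J) * eI (suc a ∷ J) x))
      ≡⟨ ∑<-cong (suc m) (λ a → trans (sumComp-cong (m ∸ a) (split a))
                                      (trans (sumMap-+ _ _ (compositions (m ∸ a)))
                                             (cong₂ _+_ (sumMap-*ˡ (shift (D F) a) _ (compositions (m ∸ a)))
                                                        (sumMap-*ˡ (φ a) _ (compositions (m ∸ a)))))) ⟩
    ∑< (suc m) (λ a → shift (D F) a * Q (m ∸ a) + φ a * U (m ∸ a) (d ∸ a))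
      ≡⟨ ∑<-+ (suc m) (λ a → shift (D F) a * Q (m ∸ a)) (λ a → φ a * U (m ∸ a) (d ∸ a)) ⟩
    ∑< (suc m) (λ a → shift (D F) a * Q (m ∸ a)) + ∑< (suc m) (λ a → φ a * U (m ∸ a) (d ∸ a))
      ≡⟨ cong₂ _+_ (sym (trans (⊛-suc (D F) Q m refl) (⊛-as-∑< (shift (D F)) Q m)))
                   (∑<-truncate (suc m) _ (ℕ.m≤n⇒m≤1+n d≤m) beyond) ⟩
    cycleSeries (suc m) + ∑< d (λ a → φ a * U (m ∸ a) (d ∸ a))
      ≡⟨ cong (_+_ (cycleSeries (suc m))) (∑<-U φ d m U≡) ⟩
    cycleSeries (suc m) + ∑< d (λ t → (φ ⊛ Q) t * cycleSeries (m ∸ t)) ∎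
    where
    open ≡-Reasoning
    beyond : ∀ a → d ≤ a → φ a * U (m ∸ a) (d ∸ a) ≡ + 0
    beyond a d≤a = trans (cong (λ k → φ a * U (m ∸ a) k) (ℕ.m≤n⇒m∸n≡0 d≤a))
                         (trans (cong (φ a *_) (U-zero (m ∸ a))) (ℤ.*-zeroʳ (φ a)))

  private
    cast : ∀ p q s w → + ((p ℕ.+ s) ℕ.* (q ℕ.* w)) ≡ (+ p + + s) * (+ q * + w)
    cast p q s w = trans (ℤ.pos-* (p ℕ.+ s) (q ℕ.* w)) (cong₂ _*_ (ℤ.pos-+ p s) (ℤ.pos-* q w))

    split-U : ∀ a s w E eJ → + ((suc a ℕ.+ s) ℕ.* (a ℕ.* w)) * (E * eJ) ≡
              + suc a * (+ a * E) * (+ w * eJ) + + a * E * (+ (s ℕ.* w) * eJ)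
    split-U a s w E eJ = begin
      + ((suc a ℕ.+ s) ℕ.* (a ℕ.* w)) * (E * eJ)
        ≡⟨ cong (_* (E * eJ)) (cast (suc a) a s w) ⟩
      (+ suc a + + s) * (+ a * + w) * (E * eJ)
        ≡⟨ ring (+ suc a) (+ a) (+ s) (+ w) E eJ ⟩
      + suc a * (+ a * E) * (+ w * eJ) + + a * E * (+ s * + w * eJ)
        ≡⟨ cong (λ t → + suc a * (+ a * E) * (+ w * eJ) + + a * E * (t * eJ)) (sym (ℤ.pos-* s w)) ⟩
      + suc a * (+ a * E) * (+ w * eJ) + + a * E * (+ (s ℕ.* w) * eJ) ∎
      where
      open ≡-Reasoning
      ring : ∀ A a s w E eJ → (A + s) * (a * w) * (E * eJ) ≡ A * (a * E) * (w * eJ) + a * E * (s * w * eJ)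
      ring = solve-∀

    split-G : ∀ a s w E eJ → + ((a ℕ.+ s) ℕ.* (suc a ℕ.* w)) * (E * eJ) ≡
              + suc a * (+ a * E) * (+ w * eJ) + + suc a * E * (+ (s ℕ.* w) * eJ)
    split-G a s w E eJ = begin
      + ((a ℕ.+ s) ℕ.* (suc a ℕ.* w)) * (E * eJ)
        ≡⟨ cong (_* (E * eJ)) (cast a (suc a) s w) ⟩
      (+ a + + s) * (+ suc a * + w) * (E * eJ)
        ≡⟨ ring (+ suc a) (+ a) (+ s) (+ w) E eJ ⟩
      + suc a * (+ a * E) * (+ w * eJ) + + suc a * E * (+ s * + w * eJ)
        ≡⟨ cong (λ t → + suc a * (+ a * E) * (+ w * eJ) + + suc a * E * (t * eJ)) (sym (ℤ.pos-* s w)) ⟩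
      + suc a * (+ a * E) * (+ w * eJ) + + suc a * E * (+ (s ℕ.* w) * eJ) ∎
      where
      open ≡-Reasoning
      ring : ∀ A a s w E eJ → (a + s) * (A * w) * (E * eJ) ≡ A * (a * E) * (w * eJ) + A * E * (s * w * eJ)
      ring = solve-∀

  U-formula : ∀ d m → d ≤ m → U m d ≡ ∑< d (λ s → Q s * cycleSeries (m ∸ s))
  U-formula = <-rec (λ d → ∀ m → d ≤ m → U m d ≡ ∑< d (λ s → Q s * cycleSeries (m ∸ s))) step
    where
    step : ∀ d → (∀ {d′} → d′ < d → ∀ m → d′ ≤ m → U m d′ ≡ ∑< d′ (λ s → Q s * cycleSeries (m ∸ s))) →
           ∀ m → d ≤ m → U m d ≡ ∑< d (λ s → Q s * cycleSeries (m ∸ s))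
    step zero    _   m       _         = U-zero m
    step (suc d) rec (suc m) (s≤s d≤m) = begin
      U (suc m) (suc d)
        ≡⟨ firstPart-expansion (λ J → σ⁺′ J (suc d) ℕ.* ∏[i-1] J) (shift F) d m
             (λ a J → split-U a (σ⁺′ J (d ∸ a)) (∏[i-1] J) (e (suc a) x) (eI J x)) d≤m
             (λ a _ → rec (s≤s (ℕ.m∸n≤m d a)) (m ∸ a) (ℕ.∸-monoˡ-≤ a d≤m)) ⟩
      cycleSeries (suc m) + ∑< d (λ t → (shift F ⊛ Q) t * cycleSeries (m ∸ t))
        ≡⟨ cong₂ _+_ (sym (ℤ.*-identityˡ (cycleSeries (suc m)))) (∑<-cong d (λ t → cong (_* cycleSeries (m ∸ t)) (Q-suc t))) ⟩
      Q 0 * cycleSeries (suc m) + ∑< d (λ t → Q (suc t) * cycleSeries (m ∸ t)) ∎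
      where open ≡-Reasoning

  σ⁺-path-cycle : ∀ n l → l ≤ n →
    sumComp (suc n) (λ I → + ((σ⁺′ I (suc l) ∸ 1) ℕ.* w I) * eI I x) ≡ ∑< (suc l) (λ t → pathSeries t * cycleSeries (suc n ∸ t))
  σ⁺-path-cycle n l l≤n = begin
    sumComp (suc n) (λ I → + ((σ⁺′ I (suc l) ∸ 1) ℕ.* w I) * eI I x)
      ≡⟨ firstPart-expansion (λ I → (σ⁺′ I (suc l) ∸ 1) ℕ.* w I) (shift (D (E x))) l n
           (λ a J → split-G a (σ⁺′ J (l ∸ a)) (∏[i-1] J) (e (suc a) x) (eI J x)) l≤n
           (λ a _ → U-formula (l ∸ a) (n ∸ a) (ℕ.∸-monoˡ-≤ a l≤n)) ⟩
    cycleSeries (suc n) + ∑< l (λ t → (shift (D (E x)) ⊛ Q) t * cycleSeries (n ∸ t))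
      ≡⟨ cong₂ _+_ (sym (ℤ.*-identityˡ (cycleSeries (suc n)))) (∑<-cong l (λ t → cong (_* cycleSeries (n ∸ t)) (pathSeries-suc t))) ⟩
    pathSeries 0 * cycleSeries (suc n) + ∑< l (λ t → pathSeries (suc t) * cycleSeries (n ∸ t)) ∎
    where open ≡-Reasoning

  w-pathSeries : ∀ n → sumComp (suc n) (λ I → + w I * eI I x) ≡ pathSeries (suc n)
  w-pathSeries n = begin
    sumComp (suc n) (λ I → + w I * eI I x)
      ≡⟨ sumComp-firstPart n _ ⟩
    ∑< (suc n) (λ a → sumComp (n ∸ a) (λ J → + (suc a ℕ.* ∏[i-1] J) * (e (suc a) x * eI J x)))
      ≡⟨ ∑<-cong (suc n) (λ a → trans (sumComp-cong (n ∸ a) (λ J → split a (∏[i-1] J) (e (suc a) x) (eI J x)))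
                                      (sumMap-*ˡ (shift (D (E x)) a) _ (compositions (n ∸ a)))) ⟩
    ∑< (suc n) (λ a → shift (D (E x)) a * Q (n ∸ a))
      ≡⟨ sym (⊛-as-∑< (shift (D (E x))) Q n) ⟩
    (shift (D (E x)) ⊛ Q) n
      ≡⟨ pathSeries-suc n ⟩
    pathSeries (suc n) ∎
    where
    open ≡-Reasoning
    split : ∀ a w E eJ → + (suc a ℕ.* w) * (E * eJ) ≡ + suc a * E * (+ w * eJ)
    split a w E eJ = trans (cong (_* (E * eJ)) (ℤ.pos-* (suc a) w)) (ring (+ suc a) (+ w) E eJ)
      where
      ring : ∀ A w E eJ → A * w * (E * eJ) ≡ A * E * (w * eJ)
      ring = solve-∀

  σ⁺w-path-cycle : ∀ n l → l ≤ n →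
    sumComp (suc n) (λ I → + (σ⁺′ I (suc l) ℕ.* w I) * eI I x) ≡
    pathSeries (suc n) + ∑< (suc l) (λ t → pathSeries t * cycleSeries (suc n ∸ t))
  σ⁺w-path-cycle n l l≤n = begin
    sumComp (suc n) (λ I → + (σ⁺′ I (suc l) ℕ.* w I) * eI I x)
      ≡⟨ sumComp-cong-firstPart n (λ a J → split (a ℕ.+ σ⁺′ J (l ∸ a)) (w (suc a ∷ J)) (eI (suc a ∷ J) x)) ⟩
    sumComp (suc n) (λ I → + ((σ⁺′ I (suc l) ∸ 1) ℕ.* w I) * eI I x + + w I * eI I x)
      ≡⟨ sumMap-+ _ _ (compositions (suc n)) ⟩
    sumComp (suc n) (λ I → + ((σ⁺′ I (suc l) ∸ 1) ℕ.* w I) * eI I x) + sumComp (suc n) (λ I → + w I * eI I x)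
      ≡⟨ cong₂ _+_ (σ⁺-path-cycle n l l≤n) (w-pathSeries n) ⟩
    ∑< (suc l) (λ t → pathSeries t * cycleSeries (suc n ∸ t)) + pathSeries (suc n)
      ≡⟨ ℤ.+-comm (∑< (suc l) (λ t → pathSeries t * cycleSeries (suc n ∸ t))) (pathSeries (suc n)) ⟩
    pathSeries (suc n) + ∑< (suc l) (λ t → pathSeries t * cycleSeries (suc n ∸ t)) ∎
    where
    open ≡-Reasoning
    split : ∀ k w E → + (suc k ℕ.* w) * E ≡ + (k ℕ.* w) * E + + w * E
    split k w E = trans (cong (_* E) (ℤ.pos-+ w (k ℕ.* w)))
                        (trans (ℤ.*-distribʳ-+ E (+ w) (+ (k ℕ.* w))) (ℤ.+-comm (+ w * E) (+ (k ℕ.* w) * E)))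

module Chromatic {N : ℕ} (x : Fin N → ℤ) where

  open import Data.Nat as ℕ using (zero; suc; _∸_; _≤_; z≤n; s≤s)
  import Data.Nat.Properties as ℕ
  open import Data.Nat.ListAction using (sum)
  open import Data.Integer using (+_; _+_; _*_; _-_)
  import Data.Integer.Properties as ℤ
  open import Relation.Binary.PropositionalEquality
  open import Data.Integer.Tactic.RingSolver using (solve-∀)
  open import Defs
  open Sums
  open PowerSeries
  open Newton using (E; π; newton)
  open Compositions

  open Walks x using (chromaticPaths; paths-equation; closedWalks; closedWalks-formula; cycle≡paths-closedWalks)
  open CompositionSeries x

  F-equation : F ≗ D (E x) ⊖ E x ⊕ 𝟙
  F-equation zero    = refl
  F-equation (suc k) = expand (+ k) (e (suc k) x)
    where
    expand : ∀ k e → k * e ≡ (+ 1 + k) * e - e + + 0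
    expand = solve-∀

  open PathCycleSeries (π x) (E x) F Q chromaticPaths paths-equation (newton N x) Q-equation F-equation

  path≡pathSeries : ∀ n → X (P n) x ≡ pathSeries n
  path≡pathSeries = path-formula

  cycle≡cycleSeries : ∀ r → 2 ≤ r → X (C r) x ≡ cycleSeries r
  cycle≡cycleSeries (suc zero)    (s≤s ())
  cycle≡cycleSeries (suc (suc n)) _ = begin
    X (C r) x
      ≡⟨ cycle≡paths-closedWalks n ⟩
    chromaticPaths r - closedWalks r
      ≡⟨ cong (_-_ (chromaticPaths r)) (closedWalks-formula (suc n)) ⟩
    chromaticPaths r - ((chromaticPaths ⊛ (π x ⊖ D (π x))) r + π x r)
      ≡⟨ cycle-formula r ⟩
    + 0 + cycleSeries r
      ≡⟨ ℤ.+-identityˡ _ ⟩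
    cycleSeries r ∎
    where
    open ≡-Reasoning
    r = suc (suc n)

  path-cycle-σ⁺ : ∀ n l → 2 ℕ.+ l ≤ n →
    sumRange 0 l (λ k → X (P k) x * X (C (n ∸ k)) x) ≡ sumComp n (λ I → + ((σ⁺ I (suc l) ∸ 1) ℕ.* w I) * eI I x)
  path-cycle-σ⁺ (suc n) l 2+l≤1+n@(s≤s l<n) = begin
    sumRange 0 l (λ k → X (P k) x * X (C (suc n ∸ k)) x)
      ≡⟨ sumRange≡∑< 0 l (λ k → X (P k) x * X (C (suc n ∸ k)) x) ⟩
    ∑< (suc l) (λ t → X (P t) x * X (C (suc n ∸ t)) x)
      ≡⟨ ∑<-cong< (suc l) (λ t t≤l → cong₂ _*_ (path≡pathSeries t) (cycle≡cycleSeries (suc n ∸ t) (two t (ℕ.≤-pred t≤l)))) ⟩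
    ∑< (suc l) (λ t → pathSeries t * cycleSeries (suc n ∸ t))
      ≡⟨ sym (σ⁺-path-cycle n l (ℕ.<⇒≤ l<n)) ⟩
    sumComp (suc n) (λ I → + ((σ⁺′ I (suc l) ∸ 1) ℕ.* w I) * eI I x)
      ≡⟨ sumComp-cong (suc n) (λ I → cong (λ s → + ((s ∸ 1) ℕ.* w I) * eI I x) (sym (σ⁺≡σ⁺′ I (suc l)))) ⟩
    sumComp (suc n) (λ I → + ((σ⁺ I (suc l) ∸ 1) ℕ.* w I) * eI I x) ∎
    where
    open ≡-Reasoning
    two : ∀ t → t ≤ l → 2 ≤ suc n ∸ t
    two t t≤l = ℕ.≤-trans (ℕ.≤-reflexive (sym (ℕ.m+n∸m≡n t 2)))
                          (ℕ.∸-monoˡ-≤ t (ℕ.≤-trans (ℕ.≤-reflexive (ℕ.+-comm t 2)) (ℕ.≤-trans (ℕ.+-monoʳ-≤ 2 t≤l) 2+l≤1+n)))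

  σ⁻-complement : ∀ n m I → sum I ≡ n →
    + (σ⁻ (rev I) m ℕ.* w I) * eI I x ≡ + n * (+ w I * eI I x) - + (σ⁺′ I (n ∸ m) ℕ.* w I) * eI I x
  σ⁻-complement n m I refl = trans (cong (λ s → + (s ℕ.* w I) * eI I x) (σ⁻-reverse I m))
                                   (complement (σ⁺′-≤ I (sum I ∸ m)))
    where
    complement : ∀ {s n} → s ≤ n → + ((n ∸ s) ℕ.* w I) * eI I x ≡ + n * (+ w I * eI I x) - + (s ℕ.* w I) * eI I x
    complement {s} {n} s≤n = begin
      + ((n ∸ s) ℕ.* w I) * eI I x          ≡⟨ cong (_* eI I x) (ℤ.pos-* (n ∸ s) (w I)) ⟩
      + (n ∸ s) * + w I * eI I x            ≡⟨ cong (λ d → d * + w I * eI I x) (sym (trans (ℤ.m-n≡m⊖n n s) (ℤ.⊖-≥ s≤n))) ⟩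
      (+ n - + s) * + w I * eI I x          ≡⟨ distribute (+ n) (+ s) (+ w I) (eI I x) ⟩
      + n * (+ w I * eI I x) - + s * + w I * eI I x
                                            ≡⟨ cong (λ t → + n * (+ w I * eI I x) - t * eI I x) (sym (ℤ.pos-* s (w I))) ⟩
      + n * (+ w I * eI I x) - + (s ℕ.* w I) * eI I x ∎
      where
      open ≡-Reasoning
      distribute : ∀ n s w E → (n - s) * w * E ≡ n * (w * E) - s * w * E
      distribute = solve-∀

  n*w≡σ⁺w : ∀ n → + n * sumComp n (λ I → + w I * eI I x) ≡ sumComp n (λ I → + (σ⁺′ I n ℕ.* w I) * eI I x)
  n*w≡σ⁺w n = trans (sym (sumMap-*ˡ (+ n) _ (compositions n))) (sumComp-cong-sum n full)
    where
    full : ∀ I → sum I ≡ n → + n * (+ w I * eI I x) ≡ + (σ⁺′ I n ℕ.* w I) * eI I x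
    full I ΣI≡n = trans (sym (ℤ.*-assoc (+ n) (+ w I) (eI I x)))
      (cong (_* eI I x) (trans (sym (ℤ.pos-* n (w I)))
        (cong (λ s → + (s ℕ.* w I)) (sym (trans (cong (σ⁺′ I) (sym ΣI≡n)) (trans (σ⁺′-sum I) ΣI≡n))))))

  cycle-path-σ⁻ : ∀ n m → 2 ≤ m → suc m ≤ n →
    sumRange 2 m (λ i → X (C i) x * X (P (n ∸ i)) x) ≡ sumComp n (λ I → + (σ⁻ (rev I) m ℕ.* w I) * eI I x)
  cycle-path-σ⁻ (suc n) (suc k) _ (s≤s k<n) = begin
    sumRange 2 (suc k) (λ i → X (C i) x * X (P (suc n ∸ i)) x)
      ≡⟨ sumRange≡∑< 2 (suc k) (λ i → X (C i) x * X (P (suc n ∸ i)) x) ⟩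
    ∑< k (λ j → X (C (2 ℕ.+ j)) x * X (P (n ∸ suc j)) x)
      ≡⟨ ∑<-cong k (λ j → cong₂ _*_ (cycle≡cycleSeries (2 ℕ.+ j) (s≤s (s≤s z≤n))) (path≡pathSeries (n ∸ suc j))) ⟩
    ∑< k (λ j → cycleSeries (2 ℕ.+ j) * pathSeries (n ∸ suc j))
      ≡⟨ ∑<-reflect n k pathSeries cycleSeries cycleSeries-1 k<n ⟩
    S (suc n) - S (n ∸ k)
      ≡⟨ sym (cancel (pathSeries (suc n)) (S (suc n)) (S (n ∸ k))) ⟩
    (pathSeries (suc n) + S (suc n)) - (pathSeries (suc n) + S (n ∸ k))
      ≡⟨ sym (cong₂ _-_ (trans (n*w≡σ⁺w (suc n)) (σ⁺w-path-cycle n n ℕ.≤-refl)) tail) ⟩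
    + suc n * sumComp (suc n) (λ I → + w I * eI I x) - sumComp (suc n) (λ I → + (σ⁺′ I (n ∸ k) ℕ.* w I) * eI I x)
      ≡⟨ sym (trans (sumMap-sub _ _ (compositions (suc n)))
                    (cong (_- sumComp (suc n) (λ I → + (σ⁺′ I (n ∸ k) ℕ.* w I) * eI I x))
                          (sumMap-*ˡ (+ suc n) _ (compositions (suc n))))) ⟩
    sumComp (suc n) (λ I → + suc n * (+ w I * eI I x) - + (σ⁺′ I (n ∸ k) ℕ.* w I) * eI I x)
      ≡⟨ sym (sumComp-cong-sum (suc n) (λ I → σ⁻-complement (suc n) (suc k) I)) ⟩
    sumComp (suc n) (λ I → + (σ⁻ (rev I) (suc k) ℕ.* w I) * eI I x) ∎
    where
    open ≡-Reasoning
    S = λ j → ∑< j (λ t → pathSeries t * cycleSeries (suc n ∸ t))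
    cancel : ∀ a b c → (a + b) - (a + c) ≡ b - c
    cancel = solve-∀
    tail : sumComp (suc n) (λ I → + (σ⁺′ I (n ∸ k) ℕ.* w I) * eI I x) ≡ pathSeries (suc n) + S (n ∸ k)
    tail = subst (λ c → sumComp (suc n) (λ I → + (σ⁺′ I c ℕ.* w I) * eI I x) ≡ pathSeries (suc n) + S c)
                 (sym (ℕ.+-∸-assoc 1 k<n)) (σ⁺w-path-cycle n (n ∸ suc k) (ℕ.m∸n≤m n (suc k)))

open import Defs
open import Data.Nat using (suc; _∸_; _≤_; _+_)
import Data.Nat.Properties as ℕ
open import Data.Integer using (+_; _*_)
open import Data.Product using (_×_; _,_)
open import Relation.Binary.PropositionalEquality using (_≡_; subst)

lemma2p11 : (n : ℕ) →
  ((l : ℕ) → l + 2 ≤ n → (N : ℕ) (x : Fin N → ℤ) →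
    sumRange 0 l (λ k → X (P k) x * X (C (n ∸ k)) x)
      ≡ sumComp n (λ I → + ((σ⁺ I (suc l) ∸ 1) Data.Nat.* w I) * eI I x))
  ×
  ((m : ℕ) → 2 ≤ m → m + 1 ≤ n → (N : ℕ) (x : Fin N → ℤ) →
    sumRange 2 m (λ i → X (C i) x * X (P (n ∸ i)) x)
      ≡ sumComp n (λ I → + (σ⁻ (rev I) m Data.Nat.* w I) * eI I x))
lemma2p11 n =
  (λ l l+2≤n N x → Chromatic.path-cycle-σ⁺ x n l (subst (_≤ n) (ℕ.+-comm l 2) l+2≤n)) ,
  (λ m 2≤m m+1≤n N x → Chromatic.cycle-path-σ⁻ x n m 2≤m (subst (_≤ n) (ℕ.+-comm m 1) m+1≤n))
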